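{- Let $u_1,u_2,u_3,v_1,v_2\in\mathbb{Q}$ be such that (1) $u_2,u_3,v_1\ne0$; (2) $iv_1\ne u_2$ for all $i\in\mathbb{N}$; (3) $(i^2v_1-iu_2)v_2\ne u_1u_3$ for all $i\in\mathbb{N}$. Let $x\in\mathbb{Q}((t^{ -1}))$ be a solution of $(v_1t^2+v_2)x'=u_1+u_2tx+u_3x^2$ with $\deg x\ge1$. Then $x$ has the continued fraction expansion with $\beta_0=u_3$, $a_i=\alpha_it$ for $i\ge0$, and $\beta_i$ for $i\ge1$, where $$\alpha_i=(2i+1)v_1-u_2,\qquad \beta_i=(i^2v_1-iu_2)v_2-u_1u_3,$$ that is, $x=\frac{1}{u_3}\Big(\alpha_0t+\cfrac{\beta_1}{\alpha_1t+\cfrac{\beta_2}{\alpha_2t+\cdots}}\Big)$.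
   Context: $\mathbb{Q}((t^{ -1}))$ is the field of formal Laurent series $\sum_{k\ge -d}c_kt^{ -k}$, $c_k\in\mathbb{Q}$; the degree of a nonzero series is the largest $d$ with $c_{ -d}\ne0$; $'$ denotes $d/dt$. Given nonzero rationals $\beta_0,\beta_1,\dots$ and polynomials $a_0,a_1,\dots\in\mathbb{Q}[t]$, a series $x$ is said to have the continued fraction expansion $\frac{1}{\beta_0}\Big(a_0+\cfrac{\beta_1}{a_1+\cfrac{\beta_2}{a_2+\cdots}}\Big)$ if, setting $x_0=x$ and $x_{i+1}=1/(\beta_ix_i-a_i)$, for every $i\ge0$ one has $\beta_ix_i-a_i\ne0$ and $\deg(\beta_ix_i-a_i)<0$. -}

module Defs where

open import Data.Nat as ℕ using (ℕ; zero; suc; _∸_)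
open import Data.Integer as ℤ using (ℤ; +_; -[1+_])
open import Data.Rational as ℚ using (ℚ; 0ℚ; 1ℚ)
open import Data.Product using (Σ; _×_; ∃)
open import Relation.Binary.PropositionalEquality using (_≡_)
open import Relation.Nullary using (¬_)

-- A formal Laurent series in t⁻¹ over ℚ:  Σ_{k ≥ 0} c k · t^(top - k).
-- Every element of ℚ((t⁻¹)) has such a representation (non-uniquely).
record Laurent : Set where
  constructor mkL
  field
    top : ℤ
    c   : ℕ → ℚ
open Laurent public

ℤ→ℚ : ℤ → ℚ
ℤ→ℚ z = z ℚ./ 1

ℕ→ℚ : ℕ → ℚ
ℕ→ℚ n = ℤ→ℚ (+ n)

coef : Laurent → ℤ → ℚ
coef x n with top x ℤ.- n
... | + k      = c x k
... | -[1+ _ ] = 0ℚ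

infix 4 _≈_
_≈_ : Laurent → Laurent → Set
x ≈ y = ∀ (n : ℤ) → coef x n ≡ coef y n

sumTo : (ℕ → ℚ) → ℕ → ℚ
sumTo f zero    = 0ℚ
sumTo f (suc n) = sumTo f n ℚ.+ f n

infixl 6 _⊕_ _⊖_
infixl 7 _⊗_ _·_

_⊕_ : Laurent → Laurent → Laurent
x ⊕ y = mkL T (λ k → coef x (T ℤ.- + k) ℚ.+ coef y (T ℤ.- + k))
  where T = top x ℤ.⊔ top y

_·_ : ℚ → Laurent → Laurent
q · x = mkL (top x) (λ k → q ℚ.* c x k)

_⊖_ : Laurent → Laurent → Laurent
x ⊖ y = x ⊕ (ℚ.- 1ℚ) · y

_⊗_ : Laurent → Laurent → Laurent
x ⊗ y = mkL (top x ℤ.+ top y)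
            (λ k → sumTo (λ j → c x j ℚ.* c y (k ∸ j)) (suc k))

deriv : Laurent → Laurent
deriv x = mkL (top x ℤ.- + 1) (λ k → ℤ→ℚ (top x ℤ.- + k) ℚ.* c x k)

const : ℚ → Laurent
const q = mkL (+ 0) (λ { zero → q ; (suc _) → 0ℚ })

tL : Laurent
tL = mkL (+ 1) (λ { zero → 1ℚ ; (suc _) → 0ℚ })

NonZeroL : Laurent → Set
NonZeroL x = ∃ λ (n : ℤ) → ¬ (coef x n ≡ 0ℚ)

DegNeg : Laurent → Set
DegNeg x = ∀ (n : ℕ) → coef x (+ n) ≡ 0ℚ

DegGe1 : Laurent → Set
DegGe1 x = ∃ λ (n : ℕ) → ¬ (coef x (+ suc n) ≡ 0ℚ)

-- x has the continued fraction expansion (1/β₀)(a₀ + β₁/(a₁ + β₂/(a₂ + ⋯))):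
-- there are x₀ = x, x₁, … with β_i x_i - a_i ≠ 0, deg(β_i x_i - a_i) < 0
-- and x_{i+1} = 1/(β_i x_i - a_i) (i.e. x_{i+1} · (β_i x_i - a_i) = 1).
HasCF : Laurent → (ℕ → ℚ) → (ℕ → Laurent) → Set
HasCF x β a = Σ (ℕ → Laurent) λ xs →
  (xs 0 ≈ x) ×
  (∀ (i : ℕ) → NonZeroL (β i · xs i ⊖ a i)
             × DegNeg (β i · xs i ⊖ a i)
             × (xs (suc i) ⊗ (β i · xs i ⊖ a i) ≈ const 1ℚ))

alphaCF : (u₂ v₁ : ℚ) → ℕ → ℚ
alphaCF u₂ v₁ i = ℕ→ℚ (suc (2 ℕ.* i)) ℚ.* v₁ ℚ.- u₂

betaCF : (u₁ u₂ u₃ v₁ v₂ : ℚ) → ℕ → ℚ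
betaCF u₁ u₂ u₃ v₁ v₂ i =
  (ℕ→ℚ i ℚ.* ℕ→ℚ i ℚ.* v₁ ℚ.- ℕ→ℚ i ℚ.* u₂) ℚ.* v₂ ℚ.- u₁ ℚ.* u₃

betaSeq : (u₁ u₂ u₃ v₁ v₂ : ℚ) → ℕ → ℚ
betaSeq u₁ u₂ u₃ v₁ v₂ zero    = u₃
betaSeq u₁ u₂ u₃ v₁ v₂ (suc j) = betaCF u₁ u₂ u₃ v₁ v₂ (suc j)

aSeq : (u₂ v₁ : ℚ) → ℕ → Laurent
aSeq u₂ v₁ i = alphaCF u₂ v₁ i · tL

-- Put s = 1/t and write a solution of degree 1 as x = t·P(s) with P a power series. Then
-- x′ = P − θP for the Euler derivation θ = s·d/ds, and after division by t² the equation reads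
--   (v₁ + v₂s²)(P − θP) = U₁s² + U₂P + U₃P²                    (Riccati v₁ v₂ U₁ U₂ U₃ P)
-- with (U₁, U₂, U₃) = (u₁, u₂, u₃). There are no solutions of degree N ≥ 2, because the
-- coefficient of t^(2N) in the equation is u₃ times the square of the leading coefficient.
-- One step of the expansion: if P(0) ≠ 0, the coefficients of s⁰ and s¹ give U₃P(0) = α := v₁ − U₂
-- and, since U₂ + 2α ≠ 0, that Y := U₃P − α = s²W. So β x − α t = s·W, and the constant term of
-- the equation satisfied by W reads (v₁ + U₂ + 2α)·W(0) = αv₂ − U₁U₃ ≠ 0. The next complete
-- quotient t·W⁻¹(s) again solves an equation of this shape, with parameters (−1, U₂ − 2v₁, αv₂ − U₁U₃).
-- Starting from (u₁, u₂, u₃), step i has U₂ = u₂ − 2iv₁, α = α_i and U₃ = β_i, and hypotheses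
-- (2) and (3) are exactly the two nondegeneracy conditions U₂ + 2α ≠ 0 and αv₂ ≠ U₁U₃.

module Submission where

open import Defs
open import Data.Nat as ℕ using (ℕ; zero; suc)
open import Data.Rational using (ℚ; 0ℚ; _+_; _*_; _-_)
open import Data.Product using (_×_)
open import Relation.Binary.PropositionalEquality using (_≡_)
open import Relation.Nullary using (¬_)

open import Algebra.Bundles using (CommutativeRing)
import Algebra.Properties.Group as GroupProperties
import Algebra.Solver.Ring
import Algebra.Solver.Ring.AlmostCommutativeRing as ACR
open import Algebra.Structures using (IsCommutativeRing)
open import Data.Empty using (⊥-elim)
open import Data.Integer as ℤ using (ℤ; +_; -[1+_])
import Data.Integer.Properties as ℤP
import Data.Integer.Tactic.RingSolver as ℤ-Solver
open import Data.Maybe using (just; nothing)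
open import Data.Nat using (_∸_; _<_; s≤s; z≤n)
import Data.Nat.Properties as ℕP
import Data.Nat.Tactic.RingSolver as ℕ-Solver
open import Data.Product using (Σ; _,_)
open import Data.Rational as ℚ using (1ℚ; -_)
import Data.Rational.Properties as ℚP
open import Data.Rational.Unnormalised as ℚᵘ using (mkℚᵘ; *≡*)
import Data.Rational.Unnormalised.Properties as ℚᵘP
open import Data.Sum using (inj₁; inj₂)
open import Function using (_∘_)
open import Level using (0ℓ)
open import Relation.Binary.Bundles using (Setoid)
open import Relation.Binary.Definitions using (WeaklyDecidable)
open import Relation.Binary.PropositionalEquality using (_≢_; refl; sym; trans; cong; cong₂; subst; subst₂; module ≡-Reasoning)
import Relation.Binary.Reasoning.Setoid as SetoidReasoning
open import Relation.Binary.Structures using (IsEquivalence)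
open import Relation.Nullary using (yes; no; contradiction)
open import Tactic.RingSolver using (solve-∀)
import Tactic.RingSolver.Core.AlmostCommutativeRing as Reflective

ℚ-ring : Reflective.AlmostCommutativeRing 0ℓ 0ℓ
ℚ-ring = Reflective.fromCommutativeRing ℚP.+-*-commutativeRing is-zero?
  where
  is-zero? : ∀ p → _
  is-zero? p with 0ℚ ℚP.≟ p
  ... | yes 0≡p = just 0≡p
  ... | no _    = nothing

p≢0∧p*q≡0⇒q≡0 : ∀ {p q} → p ≢ 0ℚ → p * q ≡ 0ℚ → q ≡ 0ℚ
p≢0∧p*q≡0⇒q≡0 {p} {q} p≢0 pq≡0 = begin
  q               ≡⟨ sym (ℚP.*-identityˡ q) ⟩
  1ℚ * q          ≡⟨ cong (_* q) (sym (ℚP.*-inverseˡ p)) ⟩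
  ℚ.1/ p * p * q  ≡⟨ ℚP.*-assoc (ℚ.1/ p) p q ⟩
  ℚ.1/ p * (p * q) ≡⟨ cong (ℚ.1/ p *_) pq≡0 ⟩
  ℚ.1/ p * 0ℚ     ≡⟨ ℚP.*-zeroʳ (ℚ.1/ p) ⟩
  0ℚ              ∎
  where
  open ≡-Reasoning
  instance
    _ : ℚ.NonZero p
    _ = ℚ.≢-nonZero p≢0

p*p≡0⇒p≡0 : ∀ p → p * p ≡ 0ℚ → p ≡ 0ℚ
p*p≡0⇒p≡0 p pp≡0 with p ℚP.≟ 0ℚ
... | yes p≡0 = p≡0
... | no  p≢0 = p≢0∧p*q≡0⇒q≡0 p≢0 pp≡0

module ℚ-group = GroupProperties ℚP.+-0-group

ℤ→ℚ-+ : ∀ i j → ℤ→ℚ (i ℤ.+ j) ≡ ℤ→ℚ i + ℤ→ℚ j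
ℤ→ℚ-+ i j = ℚP.toℚᵘ-injective (begin
  ℚ.toℚᵘ (ℤ→ℚ (i ℤ.+ j))                ≈⟨ ℚP.toℚᵘ-fromℚᵘ (mkℚᵘ (i ℤ.+ j) 0) ⟩
  mkℚᵘ (i ℤ.+ j) 0                      ≈⟨ *≡* (numerators i j) ⟩
  mkℚᵘ i 0 ℚᵘ.+ mkℚᵘ j 0                ≈⟨ ℚᵘP.+-cong (ℚᵘP.≃-sym (ℚP.toℚᵘ-fromℚᵘ (mkℚᵘ i 0)))
                                                     (ℚᵘP.≃-sym (ℚP.toℚᵘ-fromℚᵘ (mkℚᵘ j 0))) ⟩
  ℚ.toℚᵘ (ℤ→ℚ i) ℚᵘ.+ ℚ.toℚᵘ (ℤ→ℚ j)    ≈⟨ ℚᵘP.≃-sym (ℚP.toℚᵘ-homo-+ (ℤ→ℚ i) (ℤ→ℚ j)) ⟩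
  ℚ.toℚᵘ (ℤ→ℚ i + ℤ→ℚ j)                ∎)
  where
  open ℚᵘP.≃-Reasoning
  numerators : ∀ i j → (i ℤ.+ j) ℤ.* + 1 ≡ (i ℤ.* + 1 ℤ.+ j ℤ.* + 1) ℤ.* + 1
  numerators = ℤ-Solver.solve-∀

ℕ→ℚ-+ : ∀ m n → ℕ→ℚ (m ℕ.+ n) ≡ ℕ→ℚ m + ℕ→ℚ n
ℕ→ℚ-+ m n = ℤ→ℚ-+ (+ m) (+ n)

ℕ→ℚ-suc : ∀ n → ℕ→ℚ (suc n) ≡ 1ℚ + ℕ→ℚ n
ℕ→ℚ-suc = ℕ→ℚ-+ 1

ℤ→ℚ-1-n : ∀ n → ℤ→ℚ (+ 1 ℤ.- + n) ≡ 1ℚ - ℕ→ℚ n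
ℤ→ℚ-1-n n = begin
  ℤ→ℚ (+ 1 ℤ.- + n)                          ≡⟨ lemma (ℤ→ℚ (+ 1 ℤ.- + n)) (ℕ→ℚ n) ⟩
  (ℤ→ℚ (+ 1 ℤ.- + n) + ℕ→ℚ n) - ℕ→ℚ n        ≡⟨ cong (_- ℕ→ℚ n) (sym (ℤ→ℚ-+ (+ 1 ℤ.- + n) (+ n))) ⟩
  ℤ→ℚ ((+ 1 ℤ.- + n) ℤ.+ + n) - ℕ→ℚ n        ≡⟨ cong (λ i → ℤ→ℚ i - ℕ→ℚ n) (minus-plus (+ 1) (+ n)) ⟩
  1ℚ - ℕ→ℚ n                                 ∎
  where
  open ≡-Reasoning
  lemma : ∀ p q → p ≡ (p + q) - q
  lemma = solve-∀ ℚ-ring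
  minus-plus : ∀ i j → (i ℤ.- j) ℤ.+ j ≡ i
  minus-plus = ℤ-Solver.solve-∀

sumTo-cong : ∀ {f g : ℕ → ℚ} n → (∀ {j} → j < n → f j ≡ g j) → sumTo f n ≡ sumTo g n
sumTo-cong zero    f≗g = refl
sumTo-cong (suc n) f≗g = cong₂ _+_ (sumTo-cong n (f≗g ∘ ℕP.m<n⇒m<1+n)) (f≗g (ℕP.n<1+n n))

sumTo-zero : ∀ {f : ℕ → ℚ} n → (∀ j → f j ≡ 0ℚ) → sumTo f n ≡ 0ℚ
sumTo-zero zero    f≡0 = refl
sumTo-zero (suc n) f≡0 = cong₂ _+_ (sumTo-zero n f≡0) (f≡0 n)

sumTo-distrib-+ : ∀ (f g : ℕ → ℚ) n → sumTo (λ j → f j + g j) n ≡ sumTo f n + sumTo g n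
sumTo-distrib-+ f g zero    = refl
sumTo-distrib-+ f g (suc n) =
  trans (cong (_+ (f n + g n)) (sumTo-distrib-+ f g n)) (interchange (sumTo f n) (sumTo g n) (f n) (g n))
  where
  interchange : ∀ a b c d → (a + b) + (c + d) ≡ (a + c) + (b + d)
  interchange = solve-∀ ℚ-ring

*-distribˡ-sumTo : ∀ a (f : ℕ → ℚ) n → a * sumTo f n ≡ sumTo (λ j → a * f j) n
*-distribˡ-sumTo a f zero    = ℚP.*-zeroʳ a
*-distribˡ-sumTo a f (suc n) =
  trans (ℚP.*-distribˡ-+ a (sumTo f n) (f n)) (cong (_+ a * f n) (*-distribˡ-sumTo a f n))

*-distribʳ-sumTo : ∀ a (f : ℕ → ℚ) n → sumTo f n * a ≡ sumTo (λ j → f j * a) n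
*-distribʳ-sumTo a f n = begin
  sumTo f n * a              ≡⟨ ℚP.*-comm (sumTo f n) a ⟩
  a * sumTo f n              ≡⟨ *-distribˡ-sumTo a f n ⟩
  sumTo (λ j → a * f j) n    ≡⟨ sumTo-cong n (λ {j} _ → ℚP.*-comm a (f j)) ⟩
  sumTo (λ j → f j * a) n    ∎
  where open ≡-Reasoning

sumTo-suc : ∀ (f : ℕ → ℚ) n → sumTo f (suc n) ≡ f 0 + sumTo (f ∘ suc) n
sumTo-suc f zero    = trans (ℚP.+-identityˡ (f 0)) (sym (ℚP.+-identityʳ (f 0)))
sumTo-suc f (suc n) =
  trans (cong (_+ f (suc n)) (sumTo-suc f n)) (ℚP.+-assoc (f 0) (sumTo (f ∘ suc) n) (f (suc n)))

sumTo-reverse : ∀ (f : ℕ → ℚ) n → sumTo f n ≡ sumTo (λ j → f (n ∸ suc j)) n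
sumTo-reverse f zero    = refl
sumTo-reverse f (suc n) = begin
  sumTo f n + f n                              ≡⟨ cong (_+ f n) (sumTo-reverse f n) ⟩
  sumTo (λ j → f (n ∸ suc j)) n + f n          ≡⟨ ℚP.+-comm _ (f n) ⟩
  f n + sumTo (λ j → f (n ∸ suc j)) n          ≡⟨ sym (sumTo-suc (λ j → f (suc n ∸ suc j)) n) ⟩
  sumTo (λ j → f (suc n ∸ suc j)) (suc n)      ∎
  where open ≡-Reasoning

sumTo-triangle : ∀ (F : ℕ → ℕ → ℚ) n →
  sumTo (λ j → sumTo (F j) (suc n ∸ j)) (suc n) ≡ sumTo (λ k → sumTo (λ j → F j (k ∸ j)) (suc k)) (suc n)
sumTo-triangle F zero    = refl
sumTo-triangle F (suc n) = begin
  sumTo (λ j → sumTo (F j) (2 ℕ.+ n ∸ j)) (suc n) + sumTo (F (suc n)) (2 ℕ.+ n ∸ suc n)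
    ≡⟨ cong₂ _+_ (sumTo-cong (suc n) peel-last) (cong (sumTo (F (suc n))) (ℕP.m+n∸n≡m 1 n)) ⟩
  sumTo (λ j → sumTo (F j) (suc n ∸ j) + F j (suc n ∸ j)) (suc n) + (0ℚ + F (suc n) 0)
    ≡⟨ cong (_+ (0ℚ + F (suc n) 0)) (sumTo-distrib-+ _ _ (suc n)) ⟩
  (sumTo (λ j → sumTo (F j) (suc n ∸ j)) (suc n) + S) + (0ℚ + F (suc n) 0)
    ≡⟨ cong (λ r → (r + S) + (0ℚ + F (suc n) 0)) (sumTo-triangle F n) ⟩
  (R + S) + (0ℚ + F (suc n) 0)
    ≡⟨ regroup R S (F (suc n) 0) ⟩
  R + (S + F (suc n) 0)
    ≡⟨ cong (λ m → R + (S + F (suc n) m)) (sym (ℕP.n∸n≡0 n)) ⟩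
  R + (S + F (suc n) (n ∸ n))
    ∎
  where
  open ≡-Reasoning
  R = sumTo (λ k → sumTo (λ j → F j (k ∸ j)) (suc k)) (suc n)
  S = sumTo (λ j → F j (suc n ∸ j)) (suc n)
  regroup : ∀ r s f → (r + s) + (0ℚ + f) ≡ r + (s + f)
  regroup = solve-∀ ℚ-ring
  peel-last : ∀ {j} → j < suc n → sumTo (F j) (2 ℕ.+ n ∸ j) ≡ sumTo (F j) (suc n ∸ j) + F j (suc n ∸ j)
  peel-last {j} (s≤s j≤n) = cong (sumTo (F j)) (ℕP.+-∸-assoc 1 (ℕP.m≤n⇒m≤1+n j≤n))

-- The ring ℚ[[s]] of formal power series

PowerSeries : Set
PowerSeries = ℕ → ℚ

infix 4 _≐_
-- A record rather than a Π-type, so that both series can be inferred from an equation.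
record _≐_ (f g : PowerSeries) : Set where
  constructor pointwise
  field at : ∀ k → f k ≡ g k
open _≐_ public

ι : ℚ → PowerSeries
ι a zero    = a
ι a (suc _) = 0ℚ

𝟘 𝟙 : PowerSeries
𝟘 = ι 0ℚ
𝟙 = ι 1ℚ

𝟘-at : ∀ k → 𝟘 k ≡ 0ℚ
𝟘-at zero    = refl
𝟘-at (suc k) = refl

infixl 6 _⊞_
infixl 7 _⊛_

opaque
  _⊞_ : PowerSeries → PowerSeries → PowerSeries
  (f ⊞ g) k = f k + g k

  ⊟_ : PowerSeries → PowerSeries
  (⊟ f) k = - f k

  _⊛_ : PowerSeries → PowerSeries → PowerSeries
  (f ⊛ g) k = sumTo (λ j → f j * g (k ∸ j)) (suc k)

  ⊞-at : ∀ f g k → (f ⊞ g) k ≡ f k + g k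
  ⊞-at f g k = refl

  ⊟-at : ∀ f k → (⊟ f) k ≡ - f k
  ⊟-at f k = refl

  ⊛-at : ∀ f g k → (f ⊛ g) k ≡ sumTo (λ j → f j * g (k ∸ j)) (suc k)
  ⊛-at f g k = refl

≐-refl : ∀ {f} → f ≐ f
≐-refl = pointwise λ _ → refl

≐-sym : ∀ {f g} → f ≐ g → g ≐ f
≐-sym f≐g = pointwise λ k → sym (f≐g .at k)

≐-trans : ∀ {f g h} → f ≐ g → g ≐ h → f ≐ h
≐-trans f≐g g≐h = pointwise λ k → trans (f≐g .at k) (g≐h .at k)

≐-reflexive : ∀ {f g} → f ≡ g → f ≐ g
≐-reflexive refl = ≐-refl

≐-isEquivalence : IsEquivalence _≐_
≐-isEquivalence = record { refl = ≐-refl ; sym = ≐-sym ; trans = ≐-trans }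

≐-setoid : Setoid _ _
≐-setoid = record { isEquivalence = ≐-isEquivalence }

module ≐-Reasoning = SetoidReasoning ≐-setoid

⊛-at-0 : ∀ f g → (f ⊛ g) 0 ≡ f 0 * g 0
⊛-at-0 f g = trans (⊛-at f g 0) (ℚP.+-identityˡ (f 0 * g 0))

⊛-at-1 : ∀ f g → (f ⊛ g) 1 ≡ f 0 * g 1 + f 1 * g 0
⊛-at-1 f g = trans (⊛-at f g 1) (cong (_+ f 1 * g 0) (ℚP.+-identityˡ (f 0 * g 1)))

ι-⊛-at : ∀ a f k → (ι a ⊛ f) k ≡ a * f k
ι-⊛-at a f k = begin
  (ι a ⊛ f) k                                   ≡⟨ ⊛-at (ι a) f k ⟩
  sumTo (λ j → ι a j * f (k ∸ j)) (suc k)       ≡⟨ sumTo-suc (λ j → ι a j * f (k ∸ j)) k ⟩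
  a * f k + sumTo (λ j → 0ℚ * f (k ∸ suc j)) k  ≡⟨ cong (λ r → a * f k + r) (sumTo-zero k λ j → ℚP.*-zeroˡ (f (k ∸ suc j))) ⟩
  a * f k + 0ℚ                                  ≡⟨ ℚP.+-identityʳ (a * f k) ⟩
  a * f k                                       ∎
  where open ≡-Reasoning

opaque
  unfolding _⊞_ ⊟_ _⊛_

  ⊞-cong : ∀ {f f′ g g′} → f ≐ f′ → g ≐ g′ → f ⊞ g ≐ f′ ⊞ g′
  ⊞-cong f≐f′ g≐g′ = pointwise λ k → cong₂ _+_ (f≐f′ .at k) (g≐g′ .at k)

  ⊟-cong : ∀ {f f′} → f ≐ f′ → ⊟ f ≐ ⊟ f′
  ⊟-cong f≐f′ = pointwise λ k → cong -_ (f≐f′ .at k)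

  ⊛-cong : ∀ {f f′ g g′} → f ≐ f′ → g ≐ g′ → f ⊛ g ≐ f′ ⊛ g′
  ⊛-cong f≐f′ g≐g′ = pointwise λ k → sumTo-cong (suc k) λ {j} _ → cong₂ _*_ (f≐f′ .at j) (g≐g′ .at (k ∸ j))

  ⊞-assoc : ∀ f g h → (f ⊞ g) ⊞ h ≐ f ⊞ (g ⊞ h)
  ⊞-assoc f g h = pointwise λ k → ℚP.+-assoc (f k) (g k) (h k)

  ⊞-comm : ∀ f g → f ⊞ g ≐ g ⊞ f
  ⊞-comm f g = pointwise λ k → ℚP.+-comm (f k) (g k)

  ⊞-identityˡ : ∀ f → 𝟘 ⊞ f ≐ f
  ⊞-identityˡ f = pointwise λ k → trans (cong (_+ f k) (𝟘-at k)) (ℚP.+-identityˡ (f k))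

  ⊞-identityʳ : ∀ f → f ⊞ 𝟘 ≐ f
  ⊞-identityʳ f = pointwise λ k → trans (cong (λ r → f k + r) (𝟘-at k)) (ℚP.+-identityʳ (f k))

  ⊞-inverseˡ : ∀ f → ⊟ f ⊞ f ≐ 𝟘
  ⊞-inverseˡ f = pointwise λ k → trans (ℚP.+-inverseˡ (f k)) (sym (𝟘-at k))

  ⊞-inverseʳ : ∀ f → f ⊞ ⊟ f ≐ 𝟘
  ⊞-inverseʳ f = pointwise λ k → trans (ℚP.+-inverseʳ (f k)) (sym (𝟘-at k))

  ⊛-comm : ∀ f g → f ⊛ g ≐ g ⊛ f
  ⊛-comm f g = pointwise λ k → trans (sumTo-reverse (λ j → f j * g (k ∸ j)) (suc k))
    (sumTo-cong (suc k) λ {j} j<1+k →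
      trans (cong (λ i → f (k ∸ j) * g i) (ℕP.m∸[m∸n]≡n (ℕP.m<1+n⇒m≤n j<1+k))) (ℚP.*-comm (f (k ∸ j)) (g j)))

  ⊛-assoc : ∀ f g h → (f ⊛ g) ⊛ h ≐ f ⊛ (g ⊛ h)
  ⊛-assoc f g h = pointwise λ k → begin
    sumTo (λ m → sumTo (λ j → f j * g (m ∸ j)) (suc m) * h (k ∸ m)) (suc k)
      ≡⟨ sumTo-cong (suc k) (λ {m} _ → *-distribʳ-sumTo (h (k ∸ m)) (λ j → f j * g (m ∸ j)) (suc m)) ⟩
    sumTo (λ m → sumTo (λ j → f j * g (m ∸ j) * h (k ∸ m)) (suc m)) (suc k)
      ≡⟨ sumTo-cong (suc k) (λ m<1+k → sumTo-cong _ λ j<1+m →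
           reassociate (ℕP.m<1+n⇒m≤n m<1+k) (ℕP.m<1+n⇒m≤n j<1+m)) ⟩
    sumTo (λ m → sumTo (λ j → F k j (m ∸ j)) (suc m)) (suc k)
      ≡⟨ sym (sumTo-triangle (F k) k) ⟩
    sumTo (λ j → sumTo (F k j) (suc k ∸ j)) (suc k)
      ≡⟨ sumTo-cong (suc k) (λ j<1+k → cong (sumTo (F k _)) (ℕP.+-∸-assoc 1 (ℕP.m<1+n⇒m≤n j<1+k))) ⟩
    sumTo (λ j → sumTo (F k j) (suc (k ∸ j))) (suc k)
      ≡⟨ sumTo-cong (suc k) (λ {j} _ → sym (*-distribˡ-sumTo (f j) (λ l → g l * h (k ∸ j ∸ l)) (suc (k ∸ j)))) ⟩
    sumTo (λ j → f j * sumTo (λ l → g l * h (k ∸ j ∸ l)) (suc (k ∸ j))) (suc k)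
      ∎
    where
    open ≡-Reasoning
    F : ℕ → ℕ → ℕ → ℚ
    F k j l = f j * (g l * h (k ∸ j ∸ l))
    reassociate : ∀ {k m j} → m ℕ.≤ k → j ℕ.≤ m → f j * g (m ∸ j) * h (k ∸ m) ≡ F k j (m ∸ j)
    reassociate {k} {m} {j} m≤k j≤m = trans (ℚP.*-assoc (f j) (g (m ∸ j)) (h (k ∸ m)))
      (cong (λ i → f j * (g (m ∸ j) * h i))
        (sym (trans (ℕP.∸-+-assoc k j (m ∸ j)) (cong (k ∸_) (ℕP.m+[n∸m]≡n j≤m)))))

  ⊛-distribˡ : ∀ f g h → f ⊛ (g ⊞ h) ≐ f ⊛ g ⊞ f ⊛ h
  ⊛-distribˡ f g h = pointwise λ k →
    trans (sumTo-cong (suc k) (λ {j} _ → ℚP.*-distribˡ-+ (f j) (g (k ∸ j)) (h (k ∸ j))))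
          (sumTo-distrib-+ (λ j → f j * g (k ∸ j)) (λ j → f j * h (k ∸ j)) (suc k))

⊛-identityˡ : ∀ f → 𝟙 ⊛ f ≐ f
⊛-identityˡ f = pointwise λ k → trans (ι-⊛-at 1ℚ f k) (ℚP.*-identityˡ (f k))

⊛-identityʳ : ∀ f → f ⊛ 𝟙 ≐ f
⊛-identityʳ f = ≐-trans (⊛-comm f 𝟙) (⊛-identityˡ f)

⊛-distribʳ : ∀ f g h → (g ⊞ h) ⊛ f ≐ g ⊛ f ⊞ h ⊛ f
⊛-distribʳ f g h = ≐-trans (⊛-comm (g ⊞ h) f) (≐-trans (⊛-distribˡ f g h) (⊞-cong (⊛-comm f g) (⊛-comm f h)))

powerSeries-isCommutativeRing : IsCommutativeRing _≐_ _⊞_ _⊛_ ⊟_ 𝟘 𝟙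
powerSeries-isCommutativeRing = record
  { isRing = record
    { +-isAbelianGroup = record
      { isGroup = record
        { isMonoid = record
          { isSemigroup = record
            { isMagma = record { isEquivalence = ≐-isEquivalence ; ∙-cong = ⊞-cong }
            ; assoc   = ⊞-assoc
            }
          ; identity = ⊞-identityˡ , ⊞-identityʳ
          }
        ; inverse = ⊞-inverseˡ , ⊞-inverseʳ
        ; ⁻¹-cong = ⊟-cong
        }
      ; comm = ⊞-comm
      }
    ; *-cong     = ⊛-cong
    ; *-assoc    = ⊛-assoc
    ; *-identity = ⊛-identityˡ , ⊛-identityʳ
    ; distrib    = ⊛-distribˡ , ⊛-distribʳ
    }
  ; *-comm = ⊛-comm
  }

powerSeries-commutativeRing : CommutativeRing _ _
powerSeries-commutativeRing = record { isCommutativeRing = powerSeries-isCommutativeRing }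

powerSeries-almostCommutativeRing : ACR.AlmostCommutativeRing _ _
powerSeries-almostCommutativeRing = ACR.fromCommutativeRing powerSeries-commutativeRing

opaque
  unfolding _⊞_ ⊟_

  ι-+ : ∀ a b → ι (a + b) ≐ ι a ⊞ ι b
  ι-+ a b = pointwise λ { zero → refl ; (suc k) → sym (ℚP.+-identityʳ 0ℚ) }

  ι-neg : ∀ a → ι (- a) ≐ ⊟ ι a
  ι-neg a = pointwise λ { zero → refl ; (suc k) → refl }

ι-* : ∀ a b → ι (a * b) ≐ ι a ⊛ ι b
ι-* a b = pointwise λ k → sym (trans (ι-⊛-at a (ι b) k) (lemma k))
  where
  lemma : ∀ k → a * ι b k ≡ ι (a * b) k
  lemma zero    = refl
  lemma (suc k) = ℚP.*-zeroʳ a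

ι-homomorphism : ℚP.+-*-rawRing ACR.-Raw-AlmostCommutative⟶ powerSeries-almostCommutativeRing
ι-homomorphism = record
  { ⟦_⟧    = ι
  ; +-homo = ι-+
  ; *-homo = ι-*
  ; -‿homo = ι-neg
  ; 0-homo = ≐-refl
  ; 1-homo = ≐-refl
  }

ι-≟ : WeaklyDecidable (ACR.Induced-equivalence ι-homomorphism)
ι-≟ a b with a ℚP.≟ b
... | yes refl = just ≐-refl
... | no _     = nothing

open Algebra.Solver.Ring ℚP.+-*-rawRing powerSeries-almostCommutativeRing ι-homomorphism ι-≟
  using (solve; _:=_; _:+_; _:*_; :-_; _:-_; con)

s² : PowerSeries
s² 2 = 1ℚ
s² _ = 0ℚ

s²⊛-at-0 : ∀ f → (s² ⊛ f) 0 ≡ 0ℚ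
s²⊛-at-0 f = trans (⊛-at-0 s² f) (ℚP.*-zeroˡ (f 0))

s²⊛-at-1 : ∀ f → (s² ⊛ f) 1 ≡ 0ℚ
s²⊛-at-1 f = trans (⊛-at-1 s² f) (cong₂ _+_ (ℚP.*-zeroˡ (f 1)) (ℚP.*-zeroˡ (f 0)))

s²⊛-at-2+ : ∀ f k → (s² ⊛ f) (2 ℕ.+ k) ≡ f k
s²⊛-at-2+ f k = begin
  (s² ⊛ f) (2 ℕ.+ k)
    ≡⟨ ⊛-at s² f (2 ℕ.+ k) ⟩
  sumTo (λ j → s² j * f (2 ℕ.+ k ∸ j)) (3 ℕ.+ k)
    ≡⟨ sumTo-suc _ (2 ℕ.+ k) ⟩
  0ℚ * f₂ + sumTo (λ j → s² (1 ℕ.+ j) * f (1 ℕ.+ k ∸ j)) (2 ℕ.+ k)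
    ≡⟨ cong (λ r → 0ℚ * f₂ + r) (sumTo-suc _ (1 ℕ.+ k)) ⟩
  0ℚ * f₂ + (0ℚ * f₁ + sumTo (λ j → s² (2 ℕ.+ j) * f (k ∸ j)) (1 ℕ.+ k))
    ≡⟨ cong (λ r → 0ℚ * f₂ + (0ℚ * f₁ + r)) (sumTo-suc _ k) ⟩
  0ℚ * f₂ + (0ℚ * f₁ + (1ℚ * f k + sumTo (λ j → 0ℚ * f (k ∸ suc j)) k))
    ≡⟨ cong (λ r → 0ℚ * f₂ + (0ℚ * f₁ + (1ℚ * f k + r))) (sumTo-zero k (λ j → ℚP.*-zeroˡ (f (k ∸ suc j)))) ⟩
  0ℚ * f₂ + (0ℚ * f₁ + (1ℚ * f k + 0ℚ))
    ≡⟨ simplify f₂ f₁ (f k) ⟩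
  f k
    ∎
  where
  open ≡-Reasoning
  f₁ = f (1 ℕ.+ k)
  f₂ = f (2 ℕ.+ k)
  simplify : ∀ a b c → 0ℚ * a + (0ℚ * b + (1ℚ * c + 0ℚ)) ≡ c
  simplify = solve-∀ ℚ-ring

s²⊛-cancel : ∀ {f} → s² ⊛ f ≐ 𝟘 → f ≐ 𝟘
s²⊛-cancel {f} s²f≐0 = pointwise λ k → trans (sym (s²⊛-at-2+ f k)) (trans (s²f≐0 .at (2 ℕ.+ k)) (sym (𝟘-at k)))

s²-factor : ∀ {f} → f 0 ≡ 0ℚ → f 1 ≡ 0ℚ → f ≐ s² ⊛ (f ∘ suc ∘ suc)
s²-factor {f} f₀≡0 f₁≡0 = pointwise λ
  { 0             → trans f₀≡0 (sym (s²⊛-at-0 _))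
  ; 1             → trans f₁≡0 (sym (s²⊛-at-1 _))
  ; (suc (suc k)) → sym (s²⊛-at-2+ _ k) }

opaque
  unfolding _⊞_ _⊛_

  θ : PowerSeries → PowerSeries
  θ f k = ℕ→ℚ k * f k

  θ-at : ∀ f k → θ f k ≡ ℕ→ℚ k * f k
  θ-at f k = refl

  θ-cong : ∀ {f g} → f ≐ g → θ f ≐ θ g
  θ-cong f≐g = pointwise λ k → cong (ℕ→ℚ k *_) (f≐g .at k)

  θ-⊞ : ∀ f g → θ (f ⊞ g) ≐ θ f ⊞ θ g
  θ-⊞ f g = pointwise λ k → ℚP.*-distribˡ-+ (ℕ→ℚ k) (f k) (g k)

  θ-ι : ∀ a → θ (ι a) ≐ 𝟘
  θ-ι a = pointwise λ { zero → ℚP.*-zeroˡ a ; (suc k) → ℚP.*-zeroʳ (ℕ→ℚ (suc k)) }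

  θ-s² : θ s² ≐ s² ⊞ s²
  θ-s² = pointwise λ { 0 → refl ; 1 → refl ; 2 → refl ; (suc (suc (suc k))) → ℚP.*-zeroʳ (ℕ→ℚ (3 ℕ.+ k)) }

  θ-⊛ : ∀ f g → θ (f ⊛ g) ≐ θ f ⊛ g ⊞ f ⊛ θ g
  θ-⊛ f g = pointwise leibniz-at
    where
    open ≡-Reasoning
    leibniz : ∀ m n a b → (m + n) * (a * b) ≡ m * a * b + a * (n * b)
    leibniz = solve-∀ ℚ-ring
    split-weight : ∀ {j} k → j ℕ.≤ k →
      ℕ→ℚ k * (f j * g (k ∸ j)) ≡ ℕ→ℚ j * f j * g (k ∸ j) + f j * (ℕ→ℚ (k ∸ j) * g (k ∸ j))
    split-weight {j} k j≤k = begin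
      ℕ→ℚ k * (f j * g (k ∸ j))                  ≡⟨ cong (λ n → ℕ→ℚ n * (f j * g (k ∸ j))) (sym (ℕP.m+[n∸m]≡n j≤k)) ⟩
      ℕ→ℚ (j ℕ.+ (k ∸ j)) * (f j * g (k ∸ j))    ≡⟨ cong (_* (f j * g (k ∸ j))) (ℕ→ℚ-+ j (k ∸ j)) ⟩
      (ℕ→ℚ j + ℕ→ℚ (k ∸ j)) * (f j * g (k ∸ j))  ≡⟨ leibniz (ℕ→ℚ j) (ℕ→ℚ (k ∸ j)) (f j) (g (k ∸ j)) ⟩
      ℕ→ℚ j * f j * g (k ∸ j) + f j * (ℕ→ℚ (k ∸ j) * g (k ∸ j)) ∎
    leibniz-at : ∀ k → θ (f ⊛ g) k ≡ (θ f ⊛ g ⊞ f ⊛ θ g) k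
    leibniz-at k = begin
      ℕ→ℚ k * sumTo (λ j → f j * g (k ∸ j)) (suc k)
        ≡⟨ *-distribˡ-sumTo (ℕ→ℚ k) (λ j → f j * g (k ∸ j)) (suc k) ⟩
      sumTo (λ j → ℕ→ℚ k * (f j * g (k ∸ j))) (suc k)
        ≡⟨ sumTo-cong (suc k) (λ j<1+k → split-weight k (ℕP.m<1+n⇒m≤n j<1+k)) ⟩
      sumTo (λ j → ℕ→ℚ j * f j * g (k ∸ j) + f j * (ℕ→ℚ (k ∸ j) * g (k ∸ j))) (suc k)
        ≡⟨ sumTo-distrib-+ _ _ (suc k) ⟩
      (θ f ⊛ g ⊞ f ⊛ θ g) k
        ∎

θ-scale : ∀ a f → θ (ι a ⊛ f) ≐ ι a ⊛ θ f
θ-scale a f = begin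
  θ (ι a ⊛ f)                  ≈⟨ θ-⊛ (ι a) f ⟩
  θ (ι a) ⊛ f ⊞ ι a ⊛ θ f      ≈⟨ ⊞-cong (⊛-cong (θ-ι a) ≐-refl) ≐-refl ⟩
  𝟘 ⊛ f ⊞ ι a ⊛ θ f            ≈⟨ solve 2 (λ f g → con 0ℚ :* f :+ g := g) ≐-refl f (ι a ⊛ θ f) ⟩
  ι a ⊛ θ f                    ∎
  where open ≐-Reasoning

module Reciprocal (W : PowerSeries) (W₀≢0 : W 0 ≢ 0ℚ) where

  private
    instance
      W₀-nonZero : ℚ.NonZero (W 0)
      W₀-nonZero = ℚ.≢-nonZero W₀≢0

    next : ℕ → (ℕ → ℚ) → ℚ
    next n Q = ℚ.1/ (W 0) * (𝟙 n - sumTo (λ i → Q i * W (n ∸ i)) n)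

    prefix : ℕ → PowerSeries
    prefix zero    j = 0ℚ
    prefix (suc n) j with j ℕP.<? n
    ... | yes _ = prefix n j
    ... | no  _ = next n (prefix n)

  W⁻¹ : PowerSeries
  W⁻¹ n = prefix (suc n) n

  private
    W⁻¹-unfold : ∀ n → W⁻¹ n ≡ next n (prefix n)
    W⁻¹-unfold n with n ℕP.<? n
    ... | yes n<n = ⊥-elim (ℕP.<-irrefl refl n<n)
    ... | no  _   = refl

    prefix-stable : ∀ n {j} → j < n → prefix n j ≡ W⁻¹ j
    prefix-stable (suc n) {j} j<1+n with j ℕP.<? n
    ... | yes j<n = prefix-stable n j<n
    ... | no  j≮n with ℕP.m≤n⇒m<n∨m≡n (ℕP.m<1+n⇒m≤n j<1+n)
    ...   | inj₁ j<n  = ⊥-elim (j≮n j<n)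
    ...   | inj₂ refl = sym (W⁻¹-unfold j)

    W⁻¹-recurrence : ∀ n → W⁻¹ n ≡ next n W⁻¹
    W⁻¹-recurrence n = trans (W⁻¹-unfold n)
      (cong (λ s → ℚ.1/ (W 0) * (𝟙 n - s)) (sumTo-cong n λ {i} i<n → cong (_* W (n ∸ i)) (prefix-stable n i<n)))

  W⁻¹⊛W : W⁻¹ ⊛ W ≐ 𝟙
  W⁻¹⊛W = pointwise λ n → begin
    (W⁻¹ ⊛ W) n                          ≡⟨ ⊛-at W⁻¹ W n ⟩
    S n + W⁻¹ n * W (n ∸ n)              ≡⟨ cong (λ m → S n + W⁻¹ n * W m) (ℕP.n∸n≡0 n) ⟩
    S n + W⁻¹ n * W 0                    ≡⟨ cong (λ q → S n + q * W 0) (W⁻¹-recurrence n) ⟩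
    S n + w * (𝟙 n - S n) * W 0          ≡⟨ regroup (S n) (𝟙 n) w (W 0) ⟩
    S n + (𝟙 n - S n) * (w * W 0)        ≡⟨ cong (λ r → S n + (𝟙 n - S n) * r) (ℚP.*-inverseˡ (W 0)) ⟩
    S n + (𝟙 n - S n) * 1ℚ               ≡⟨ cancel (S n) (𝟙 n) ⟩
    𝟙 n                                  ∎
    where
    open ≡-Reasoning
    w = ℚ.1/ (W 0)
    S : ℕ → ℚ
    S n = sumTo (λ i → W⁻¹ i * W (n ∸ i)) n
    regroup : ∀ s e w v → s + w * (e - s) * v ≡ s + (e - s) * (w * v)
    regroup = solve-∀ ℚ-ring
    cancel : ∀ s e → s + (e - s) * 1ℚ ≡ e
    cancel = solve-∀ ℚ-ring

  W⁻¹₀≢0 : W⁻¹ 0 ≢ 0ℚ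
  W⁻¹₀≢0 W⁻¹₀≡0 = ℚP.1≢0 (begin
    1ℚ               ≡⟨ sym (W⁻¹⊛W .at 0) ⟩
    (W⁻¹ ⊛ W) 0      ≡⟨ ⊛-at-0 W⁻¹ W ⟩
    W⁻¹ 0 * W 0      ≡⟨ cong (_* W 0) W⁻¹₀≡0 ⟩
    0ℚ * W 0         ≡⟨ ℚP.*-zeroˡ (W 0) ⟩
    0ℚ               ∎)
    where open ≡-Reasoning

-- The Riccati equation in ℚ[[s]]

Riccati : (v₁ v₂ U₁ U₂ U₃ : ℚ) → PowerSeries → Set
Riccati v₁ v₂ U₁ U₂ U₃ P =
  (ι v₁ ⊞ ι v₂ ⊛ s²) ⊛ (P ⊞ ⊟ θ P) ≐ ι U₁ ⊛ s² ⊞ ι U₂ ⊛ P ⊞ ι U₃ ⊛ (P ⊛ P)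

riccati-cong : ∀ {v₁ v₂ U₁ U₂ U₃ P P′} → P ≐ P′ →
  Riccati v₁ v₂ U₁ U₂ U₃ P → Riccati v₁ v₂ U₁ U₂ U₃ P′
riccati-cong {v₁} {v₂} {U₁} {U₂} {U₃} {P} {P′} P≐P′ riccati = begin
  A ⊛ (P′ ⊞ ⊟ θ P′)
    ≈⟨ ⊛-cong ≐-refl (⊞-cong P′≐P (⊟-cong (θ-cong P′≐P))) ⟩
  A ⊛ (P ⊞ ⊟ θ P)
    ≈⟨ riccati ⟩
  ι U₁ ⊛ s² ⊞ ι U₂ ⊛ P ⊞ ι U₃ ⊛ (P ⊛ P)
    ≈⟨ ⊞-cong (⊞-cong ≐-refl (⊛-cong ≐-refl P≐P′)) (⊛-cong ≐-refl (⊛-cong P≐P′ P≐P′)) ⟩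
  ι U₁ ⊛ s² ⊞ ι U₂ ⊛ P′ ⊞ ι U₃ ⊛ (P′ ⊛ P′)
    ∎
  where
  open ≐-Reasoning
  A = ι v₁ ⊞ ι v₂ ⊛ s²
  P′≐P = ≐-sym P≐P′

riccati-at : ∀ {v₁ v₂ U₁ U₂ U₃ P} → Riccati v₁ v₂ U₁ U₂ U₃ P → ∀ k →
  v₁ * (P k - ℕ→ℚ k * P k) + v₂ * (s² ⊛ (P ⊞ ⊟ θ P)) k ≡ U₁ * s² k + U₂ * P k + U₃ * (P ⊛ P) k
riccati-at {v₁} {v₂} {U₁} {U₂} {U₃} {P} riccati k = begin
  v₁ * (P k - ℕ→ℚ k * P k) + v₂ * (s² ⊛ D) k
    ≡⟨ cong (λ d → v₁ * d + v₂ * (s² ⊛ D) k) (sym D-at) ⟩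
  v₁ * D k + v₂ * (s² ⊛ D) k
    ≡⟨ sym (cong₂ _+_ (ι-⊛-at v₁ D k) (ι-⊛-at v₂ (s² ⊛ D) k)) ⟩
  (ι v₁ ⊛ D) k + (ι v₂ ⊛ (s² ⊛ D)) k
    ≡⟨ sym (⊞-at (ι v₁ ⊛ D) (ι v₂ ⊛ (s² ⊛ D)) k) ⟩
  (ι v₁ ⊛ D ⊞ ι v₂ ⊛ (s² ⊛ D)) k
    ≡⟨ sym (distribute .at k) ⟩
  ((ι v₁ ⊞ ι v₂ ⊛ s²) ⊛ D) k
    ≡⟨ riccati .at k ⟩
  (ι U₁ ⊛ s² ⊞ ι U₂ ⊛ P ⊞ ι U₃ ⊛ (P ⊛ P)) k
    ≡⟨ trans (⊞-at _ _ k) (cong (_+ (ι U₃ ⊛ (P ⊛ P)) k) (⊞-at _ _ k)) ⟩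
  (ι U₁ ⊛ s²) k + (ι U₂ ⊛ P) k + (ι U₃ ⊛ (P ⊛ P)) k
    ≡⟨ cong₂ _+_ (cong₂ _+_ (ι-⊛-at U₁ s² k) (ι-⊛-at U₂ P k)) (ι-⊛-at U₃ (P ⊛ P) k) ⟩
  U₁ * s² k + U₂ * P k + U₃ * (P ⊛ P) k
    ∎
  where
  open ≡-Reasoning
  D = P ⊞ ⊟ θ P
  D-at : D k ≡ P k - ℕ→ℚ k * P k
  D-at = trans (⊞-at P (⊟ θ P) k) (cong (λ r → P k + r) (trans (⊟-at (θ P) k) (cong -_ (θ-at P k))))
  distribute : (ι v₁ ⊞ ι v₂ ⊛ s²) ⊛ D ≐ ι v₁ ⊛ D ⊞ ι v₂ ⊛ (s² ⊛ D)
  distribute = solve 4 (λ a b s d → (a :+ b :* s) :* d := a :* d :+ b :* (s :* d)) ≐-refl (ι v₁) (ι v₂) s² D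

p≡q⇒p-q≡0 : ∀ {p q} → p ≡ q → p - q ≡ 0ℚ
p≡q⇒p-q≡0 {p} refl = ℚP.+-inverseʳ p

riccati-at-0 : ∀ {v₁ v₂ U₁ U₂ U₃ P} → Riccati v₁ v₂ U₁ U₂ U₃ P → (v₁ - U₂ - U₃ * P 0) * P 0 ≡ 0ℚ
riccati-at-0 {v₁} {v₂} {U₁} {U₂} {U₃} {P} riccati = begin
  (v₁ - U₂ - U₃ * P 0) * P 0
    ≡⟨ rearrange v₁ v₂ U₁ U₂ U₃ (P 0) ⟩
  (v₁ * (P 0 - 0ℚ * P 0) + v₂ * 0ℚ) - (U₁ * 0ℚ + U₂ * P 0 + U₃ * (P 0 * P 0))
    ≡⟨ p≡q⇒p-q≡0 (begin
         v₁ * (P 0 - 0ℚ * P 0) + v₂ * 0ℚ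
           ≡⟨ cong (λ r → v₁ * (P 0 - 0ℚ * P 0) + v₂ * r) (sym (s²⊛-at-0 _)) ⟩
         v₁ * (P 0 - 0ℚ * P 0) + v₂ * (s² ⊛ (P ⊞ ⊟ θ P)) 0
           ≡⟨ riccati-at riccati 0 ⟩
         U₁ * 0ℚ + U₂ * P 0 + U₃ * (P ⊛ P) 0
           ≡⟨ cong (λ r → U₁ * 0ℚ + U₂ * P 0 + U₃ * r) (⊛-at-0 P P) ⟩
         U₁ * 0ℚ + U₂ * P 0 + U₃ * (P 0 * P 0)
           ∎) ⟩
  0ℚ
    ∎
  where
  open ≡-Reasoning
  rearrange : ∀ v₁ v₂ U₁ U₂ U₃ a →
    (v₁ - U₂ - U₃ * a) * a ≡ (v₁ * (a - 0ℚ * a) + v₂ * 0ℚ) - (U₁ * 0ℚ + U₂ * a + U₃ * (a * a))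
  rearrange = solve-∀ ℚ-ring

riccati-at-1 : ∀ {v₁ v₂ U₁ U₂ U₃ P} → Riccati v₁ v₂ U₁ U₂ U₃ P → (U₂ + U₃ * (P 0 + P 0)) * P 1 ≡ 0ℚ
riccati-at-1 {v₁} {v₂} {U₁} {U₂} {U₃} {P} riccati = begin
  (U₂ + U₃ * (P 0 + P 0)) * P 1
    ≡⟨ rearrange v₁ v₂ U₁ U₂ U₃ (P 0) (P 1) ⟩
  (U₁ * 0ℚ + U₂ * P 1 + U₃ * (P 0 * P 1 + P 1 * P 0)) - (v₁ * (P 1 - 1ℚ * P 1) + v₂ * 0ℚ)
    ≡⟨ p≡q⇒p-q≡0 (sym (begin
         v₁ * (P 1 - 1ℚ * P 1) + v₂ * 0ℚ
           ≡⟨ cong (λ r → v₁ * (P 1 - 1ℚ * P 1) + v₂ * r) (sym (s²⊛-at-1 _)) ⟩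
         v₁ * (P 1 - 1ℚ * P 1) + v₂ * (s² ⊛ (P ⊞ ⊟ θ P)) 1
           ≡⟨ riccati-at riccati 1 ⟩
         U₁ * 0ℚ + U₂ * P 1 + U₃ * (P ⊛ P) 1
           ≡⟨ cong (λ r → U₁ * 0ℚ + U₂ * P 1 + U₃ * r) (⊛-at-1 P P) ⟩
         U₁ * 0ℚ + U₂ * P 1 + U₃ * (P 0 * P 1 + P 1 * P 0)
           ∎)) ⟩
  0ℚ
    ∎
  where
  open ≡-Reasoning
  rearrange : ∀ v₁ v₂ U₁ U₂ U₃ a b →
    (U₂ + U₃ * (a + a)) * b ≡ (U₁ * 0ℚ + U₂ * b + U₃ * (a * b + b * a)) - (v₁ * (b - 1ℚ * b) + v₂ * 0ℚ)
  rearrange = solve-∀ ℚ-ring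

riccati-translate : ∀ {v₁ v₂ U₁ U₂ U₃ α P} → v₁ ≡ α + U₂ → Riccati v₁ v₂ U₁ U₂ U₃ P →
  Riccati v₁ v₂ (U₁ * U₃ - α * v₂) (U₂ + α + α) 1ℚ (ι U₃ ⊛ P ⊞ ι (- α))
riccati-translate {v₁} {v₂} {U₁} {U₂} {U₃} {α} {P} v₁≡α+U₂ riccati = begin
  A ⊛ (Y ⊞ ⊟ θ Y)
    ≈⟨ ⊛-cong ≐-refl (⊞-cong ≐-refl (⊟-cong θY≐U₃θP)) ⟩
  A ⊛ (ι U₃ ⊛ P ⊞ ι (- α) ⊞ ⊟ (ι U₃ ⊛ θ P))
    ≈⟨ solve 5 (λ A u₃ P θP c → A :* (u₃ :* P :+ c :- u₃ :* θP) := u₃ :* (A :* (P :- θP)) :+ A :* c)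
         ≐-refl A (ι U₃) P (θ P) (ι (- α)) ⟩
  ι U₃ ⊛ (A ⊛ (P ⊞ ⊟ θ P)) ⊞ A ⊛ ι (- α)
    ≈⟨ ⊞-cong (⊛-cong ≐-refl riccati) (⊛-cong (⊞-cong ι-v₁ ≐-refl) (ι-neg α)) ⟩
  ι U₃ ⊛ (ι U₁ ⊛ s² ⊞ ι U₂ ⊛ P ⊞ ι U₃ ⊛ (P ⊛ P)) ⊞ (ι α ⊞ ι U₂ ⊞ ι v₂ ⊛ s²) ⊛ ⊟ ι α
    ≈⟨ solve 7 (λ a u₁ u₂ u₃ w s P →
         u₃ :* (u₁ :* s :+ u₂ :* P :+ u₃ :* (P :* P)) :+ (a :+ u₂ :+ w :* s) :* (:- a)
         := (u₁ :* u₃ :- a :* w) :* s :+ (u₂ :+ a :+ a) :* (u₃ :* P :- a) :+ con 1ℚ :* ((u₃ :* P :- a) :* (u₃ :* P :- a)))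
         ≐-refl (ι α) (ι U₁) (ι U₂) (ι U₃) (ι v₂) s² P ⟩
  (ι U₁ ⊛ ι U₃ ⊞ ⊟ (ι α ⊛ ι v₂)) ⊛ s² ⊞ (ι U₂ ⊞ ι α ⊞ ι α) ⊛ (ι U₃ ⊛ P ⊞ ⊟ ι α)
    ⊞ 𝟙 ⊛ ((ι U₃ ⊛ P ⊞ ⊟ ι α) ⊛ (ι U₃ ⊛ P ⊞ ⊟ ι α))
    ≈⟨ ⊞-cong (⊞-cong (⊛-cong ι-K ≐-refl) (⊛-cong ι-B Y≐)) (⊛-cong ≐-refl (⊛-cong Y≐ Y≐)) ⟩
  ι (U₁ * U₃ - α * v₂) ⊛ s² ⊞ ι (U₂ + α + α) ⊛ Y ⊞ ι 1ℚ ⊛ (Y ⊛ Y)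
    ∎
  where
  open ≐-Reasoning
  A = ι v₁ ⊞ ι v₂ ⊛ s²
  Y = ι U₃ ⊛ P ⊞ ι (- α)
  θY≐U₃θP : θ Y ≐ ι U₃ ⊛ θ P
  θY≐U₃θP = ≐-trans (θ-⊞ (ι U₃ ⊛ P) (ι (- α)))
              (≐-trans (⊞-cong (θ-scale U₃ P) (θ-ι (- α))) (⊞-identityʳ (ι U₃ ⊛ θ P)))
  Y≐ : ι U₃ ⊛ P ⊞ ⊟ ι α ≐ Y
  Y≐ = ⊞-cong ≐-refl (≐-sym (ι-neg α))
  ι-v₁ : ι v₁ ≐ ι α ⊞ ι U₂
  ι-v₁ = ≐-trans (≐-reflexive (cong ι v₁≡α+U₂)) (ι-+ α U₂)
  ι-K : ι U₁ ⊛ ι U₃ ⊞ ⊟ (ι α ⊛ ι v₂) ≐ ι (U₁ * U₃ - α * v₂)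
  ι-K = ≐-sym (≐-trans (ι-+ (U₁ * U₃) (- (α * v₂)))
                       (⊞-cong (ι-* U₁ U₃) (≐-trans (ι-neg (α * v₂)) (⊟-cong (ι-* α v₂)))))
  ι-B : ι U₂ ⊞ ι α ⊞ ι α ≐ ι (U₂ + α + α)
  ι-B = ≐-sym (≐-trans (ι-+ (U₂ + α) α) (⊞-cong (ι-+ U₂ α) ≐-refl))

ReciprocalRiccati : (v₁ v₂ K B : ℚ) → PowerSeries → Set
ReciprocalRiccati v₁ v₂ K B W =
  (ι v₁ ⊞ ι v₂ ⊛ s²) ⊛ (W ⊞ θ W) ⊞ (ι K ⊞ ι B ⊛ W ⊞ s² ⊛ (W ⊛ W)) ≐ 𝟘

riccati-divide-s² : ∀ {v₁ v₂ K B W} → Riccati v₁ v₂ K B 1ℚ (s² ⊛ W) → ReciprocalRiccati v₁ v₂ K B W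
riccati-divide-s² {v₁} {v₂} {K} {B} {W} riccati = s²⊛-cancel (begin
  s² ⊛ (A ⊛ (W ⊞ θ W) ⊞ (ι K ⊞ ι B ⊛ W ⊞ s² ⊛ (W ⊛ W)))
    ≈⟨ solve 6 (λ A K B s W θW →
         s :* (A :* (W :+ θW) :+ (K :+ B :* W :+ s :* (W :* W)))
         := (K :* s :+ B :* (s :* W) :+ con 1ℚ :* ((s :* W) :* (s :* W))) :- A :* (s :* W :- ((s :+ s) :* W :+ s :* θW)))
         ≐-refl A (ι K) (ι B) s² W (θ W) ⟩
  RHS ⊞ ⊟ (A ⊛ (s² ⊛ W ⊞ ⊟ ((s² ⊞ s²) ⊛ W ⊞ s² ⊛ θ W)))
    ≈⟨ ⊞-cong ≐-refl (⊟-cong (⊛-cong ≐-refl (⊞-cong ≐-refl (⊟-cong (≐-sym θs²W))))) ⟩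
  RHS ⊞ ⊟ (A ⊛ (s² ⊛ W ⊞ ⊟ θ (s² ⊛ W)))
    ≈⟨ ⊞-cong ≐-refl (⊟-cong riccati) ⟩
  RHS ⊞ ⊟ RHS
    ≈⟨ ⊞-inverseʳ RHS ⟩
  𝟘 ∎)
  where
  open ≐-Reasoning
  A = ι v₁ ⊞ ι v₂ ⊛ s²
  RHS = ι K ⊛ s² ⊞ ι B ⊛ (s² ⊛ W) ⊞ ι 1ℚ ⊛ ((s² ⊛ W) ⊛ (s² ⊛ W))
  θs²W : θ (s² ⊛ W) ≐ (s² ⊞ s²) ⊛ W ⊞ s² ⊛ θ W
  θs²W = ≐-trans (θ-⊛ s² W) (⊞-cong (⊛-cong θ-s² ≐-refl) ≐-refl)

θ-reciprocal : ∀ {Q W} → Q ⊛ W ≐ 𝟙 → Q ⊞ ⊟ θ Q ≐ (Q ⊛ Q) ⊛ (W ⊞ θ W)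
θ-reciprocal {Q} {W} QW≐1 = begin
  Q ⊞ ⊟ θ Q
    ≈⟨ solve 4 (λ Q θQ W θW →
         Q :- θQ
         := (Q :* Q) :* (W :+ θW) :+ ((θQ :- Q) :* (Q :* W :- con 1ℚ) :- Q :* (θQ :* W :+ Q :* θW)))
         ≐-refl Q (θ Q) W (θ W) ⟩
  (Q ⊛ Q) ⊛ (W ⊞ θ W) ⊞ ((θ Q ⊞ ⊟ Q) ⊛ (Q ⊛ W ⊞ ⊟ 𝟙) ⊞ ⊟ (Q ⊛ (θ Q ⊛ W ⊞ Q ⊛ θ W)))
    ≈⟨ ⊞-cong ≐-refl (⊞-cong (⊛-cong ≐-refl QW-1≐0) (⊟-cong (⊛-cong ≐-refl θ[QW]≐0))) ⟩
  (Q ⊛ Q) ⊛ (W ⊞ θ W) ⊞ ((θ Q ⊞ ⊟ Q) ⊛ 𝟘 ⊞ ⊟ (Q ⊛ 𝟘))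
    ≈⟨ solve 4 (λ Q θQ W θW →
         (Q :* Q) :* (W :+ θW) :+ ((θQ :- Q) :* con 0ℚ :- Q :* con 0ℚ) := (Q :* Q) :* (W :+ θW))
         ≐-refl Q (θ Q) W (θ W) ⟩
  (Q ⊛ Q) ⊛ (W ⊞ θ W)
    ∎
  where
  open ≐-Reasoning
  QW-1≐0 : Q ⊛ W ⊞ ⊟ 𝟙 ≐ 𝟘
  QW-1≐0 = ≐-trans (⊞-cong QW≐1 ≐-refl) (⊞-inverseʳ 𝟙)
  θ[QW]≐0 : θ Q ⊛ W ⊞ Q ⊛ θ W ≐ 𝟘
  θ[QW]≐0 = ≐-trans (≐-sym (θ-⊛ Q W)) (≐-trans (θ-cong QW≐1) (θ-ι 1ℚ))

riccati-reciprocal : ∀ {v₁ v₂ K B Q W} → Q ⊛ W ≐ 𝟙 → ReciprocalRiccati v₁ v₂ K B W →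
  Riccati v₁ v₂ (- 1ℚ) (- B) (- K) Q
riccati-reciprocal {v₁} {v₂} {K} {B} {Q} {W} QW≐1 reciprocal = begin
  A ⊛ (Q ⊞ ⊟ θ Q)
    ≈⟨ ⊛-cong ≐-refl (θ-reciprocal QW≐1) ⟩
  A ⊛ ((Q ⊛ Q) ⊛ (W ⊞ θ W))
    ≈⟨ solve 7 (λ A K B s Q W θW →
         A :* ((Q :* Q) :* (W :+ θW))
         := (Q :* Q) :* (A :* (W :+ θW) :+ (K :+ B :* W :+ s :* (W :* W)))
            :- (s :* ((Q :* W) :* (Q :* W)) :+ B :* (Q :* (Q :* W)) :+ K :* (Q :* Q)))
         ≐-refl A (ι K) (ι B) s² Q W (θ W) ⟩
  (Q ⊛ Q) ⊛ (A ⊛ (W ⊞ θ W) ⊞ (ι K ⊞ ι B ⊛ W ⊞ s² ⊛ (W ⊛ W)))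
    ⊞ ⊟ (s² ⊛ ((Q ⊛ W) ⊛ (Q ⊛ W)) ⊞ ι B ⊛ (Q ⊛ (Q ⊛ W)) ⊞ ι K ⊛ (Q ⊛ Q))
    ≈⟨ ⊞-cong (⊛-cong ≐-refl reciprocal)
              (⊟-cong (⊞-cong (⊞-cong (⊛-cong ≐-refl (⊛-cong QW≐1 QW≐1))
                                      (⊛-cong ≐-refl (⊛-cong ≐-refl QW≐1))) ≐-refl)) ⟩
  (Q ⊛ Q) ⊛ 𝟘 ⊞ ⊟ (s² ⊛ (𝟙 ⊛ 𝟙) ⊞ ι B ⊛ (Q ⊛ 𝟙) ⊞ ι K ⊛ (Q ⊛ Q))
    ≈⟨ solve 4 (λ K B s Q →
         (Q :* Q) :* con 0ℚ :- (s :* (con 1ℚ :* con 1ℚ) :+ B :* (Q :* con 1ℚ) :+ K :* (Q :* Q))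
         := (:- con 1ℚ) :* s :+ (:- B) :* Q :+ (:- K) :* (Q :* Q))
         ≐-refl (ι K) (ι B) s² Q ⟩
  ⊟ 𝟙 ⊛ s² ⊞ ⊟ ι B ⊛ Q ⊞ ⊟ ι K ⊛ (Q ⊛ Q)
    ≈⟨ ≐-sym (⊞-cong (⊞-cong (⊛-cong (ι-neg 1ℚ) ≐-refl) (⊛-cong (ι-neg B) ≐-refl)) (⊛-cong (ι-neg K) ≐-refl)) ⟩
  ι (- 1ℚ) ⊛ s² ⊞ ι (- B) ⊛ Q ⊞ ι (- K) ⊛ (Q ⊛ Q)
    ∎
  where
  open ≐-Reasoning
  A = ι v₁ ⊞ ι v₂ ⊛ s²

reciprocal-riccati-at-0 : ∀ {v₁ v₂ K B W} → ReciprocalRiccati v₁ v₂ K B W → (v₁ + B) * W 0 + K ≡ 0ℚ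
reciprocal-riccati-at-0 {v₁} {v₂} {K} {B} {W} reciprocal = begin
  (v₁ + B) * W 0 + K
    ≡⟨ rearrange v₁ v₂ K B (W 0) ⟩
  (v₁ + v₂ * 0ℚ) * (W 0 + 0ℚ * W 0) + (K + B * W 0 + 0ℚ)
    ≡⟨ cong₂ _+_ L-at-0 R-at-0 ⟨
  (A ⊛ (W ⊞ θ W)) 0 + (ι K ⊞ ι B ⊛ W ⊞ s² ⊛ (W ⊛ W)) 0
    ≡⟨ sym (⊞-at (A ⊛ (W ⊞ θ W)) _ 0) ⟩
  (A ⊛ (W ⊞ θ W) ⊞ (ι K ⊞ ι B ⊛ W ⊞ s² ⊛ (W ⊛ W))) 0
    ≡⟨ reciprocal .at 0 ⟩
  0ℚ
    ∎
  where
  open ≡-Reasoning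
  A = ι v₁ ⊞ ι v₂ ⊛ s²
  rearrange : ∀ v₁ v₂ K B w → (v₁ + B) * w + K ≡ (v₁ + v₂ * 0ℚ) * (w + 0ℚ * w) + (K + B * w + 0ℚ)
  rearrange = solve-∀ ℚ-ring
  L-at-0 : (A ⊛ (W ⊞ θ W)) 0 ≡ (v₁ + v₂ * 0ℚ) * (W 0 + 0ℚ * W 0)
  L-at-0 = trans (⊛-at-0 A (W ⊞ θ W))
             (cong₂ _*_ (trans (⊞-at (ι v₁) (ι v₂ ⊛ s²) 0) (cong (λ r → v₁ + r) (ι-⊛-at v₂ s² 0)))
                        (trans (⊞-at W (θ W) 0) (cong (λ r → W 0 + r) (θ-at W 0))))
  R-at-0 : (ι K ⊞ ι B ⊛ W ⊞ s² ⊛ (W ⊛ W)) 0 ≡ K + B * W 0 + 0ℚ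
  R-at-0 = trans (⊞-at (ι K ⊞ ι B ⊛ W) (s² ⊛ (W ⊛ W)) 0)
             (cong₂ _+_ (trans (⊞-at (ι K) (ι B ⊛ W) 0) (cong (λ r → K + r) (ι-⊛-at B W 0))) (s²⊛-at-0 (W ⊛ W)))

module RiccatiStep {v₁ v₂ U₁ U₂ U₃ α : ℚ} {P : PowerSeries}
  (riccati : Riccati v₁ v₂ U₁ U₂ U₃ P) (P₀≢0 : P 0 ≢ 0ℚ) (v₁≡α+U₂ : v₁ ≡ α + U₂)
  (B≢0 : U₂ + α + α ≢ 0ℚ) (K≢0 : U₁ * U₃ - α * v₂ ≢ 0ℚ) where

  B K : ℚ
  B = U₂ + α + α
  K = U₁ * U₃ - α * v₂

  Y : PowerSeries
  Y = ι U₃ ⊛ P ⊞ ι (- α)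

  Y-riccati : Riccati v₁ v₂ K B 1ℚ Y
  Y-riccati = riccati-translate v₁≡α+U₂ riccati

  Y₀≡0 : Y 0 ≡ 0ℚ
  Y₀≡0 = begin
    Y 0                              ≡⟨ trans (⊞-at (ι U₃ ⊛ P) (ι (- α)) 0) (cong (_+ - α) (ι-⊛-at U₃ P 0)) ⟩
    U₃ * P 0 + - α                   ≡⟨ rearrange α U₂ (U₃ * P 0) ⟩
    - (α + U₂ - U₂ - U₃ * P 0)       ≡⟨ cong (λ v → - (v - U₂ - U₃ * P 0)) (sym v₁≡α+U₂) ⟩
    - (v₁ - U₂ - U₃ * P 0)           ≡⟨ cong -_ leading ⟩
    - 0ℚ                             ≡⟨⟩
    0ℚ                               ∎
    where
    open ≡-Reasoning
    rearrange : ∀ a u p → p + - a ≡ - (a + u - u - p)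
    rearrange = solve-∀ ℚ-ring
    leading : v₁ - U₂ - U₃ * P 0 ≡ 0ℚ
    leading = p≢0∧p*q≡0⇒q≡0 P₀≢0 (trans (ℚP.*-comm (P 0) _) (riccati-at-0 riccati))

  Y₁≡0 : Y 1 ≡ 0ℚ
  Y₁≡0 = p≢0∧p*q≡0⇒q≡0 B≢0 (begin
    B * Y 1                            ≡⟨ simplify B (Y 1) ⟨
    (B + 1ℚ * (0ℚ + 0ℚ)) * Y 1         ≡⟨ cong (λ y → (B + 1ℚ * (y + y)) * Y 1) Y₀≡0 ⟨
    (B + 1ℚ * (Y 0 + Y 0)) * Y 1       ≡⟨ riccati-at-1 Y-riccati ⟩
    0ℚ                                 ∎)
    where
    open ≡-Reasoning
    simplify : ∀ b y → (b + 1ℚ * (0ℚ + 0ℚ)) * y ≡ b * y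
    simplify = solve-∀ ℚ-ring

  W : PowerSeries
  W = Y ∘ suc ∘ suc

  Y≐s²W : Y ≐ s² ⊛ W
  Y≐s²W = s²-factor Y₀≡0 Y₁≡0

  W-reciprocal : ReciprocalRiccati v₁ v₂ K B W
  W-reciprocal = riccati-divide-s² (riccati-cong Y≐s²W Y-riccati)

  W₀≢0 : W 0 ≢ 0ℚ
  W₀≢0 W₀≡0 = K≢0 (begin
    K                    ≡⟨ simplify (v₁ + B) K ⟨
    (v₁ + B) * 0ℚ + K    ≡⟨ cong (λ w → (v₁ + B) * w + K) W₀≡0 ⟨
    (v₁ + B) * W 0 + K   ≡⟨ reciprocal-riccati-at-0 W-reciprocal ⟩
    0ℚ                   ∎)
    where
    open ≡-Reasoning
    simplify : ∀ c k → c * 0ℚ + k ≡ k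
    simplify = solve-∀ ℚ-ring

  open Reciprocal W W₀≢0 public renaming (W⁻¹ to Q; W⁻¹⊛W to Q⊛W; W⁻¹₀≢0 to Q₀≢0)

  Q-riccati : Riccati v₁ v₂ (- 1ℚ) (- B) (- K) Q
  Q-riccati = riccati-reciprocal Q⊛W W-reciprocal

  Q⊛Y : Q ⊛ Y ≐ s²
  Q⊛Y = begin
    Q ⊛ Y          ≈⟨ ⊛-cong ≐-refl Y≐s²W ⟩
    Q ⊛ (s² ⊛ W)   ≈⟨ solve 3 (λ Q s W → Q :* (s :* W) := s :* (Q :* W)) ≐-refl Q s² W ⟩
    s² ⊛ (Q ⊛ W)   ≈⟨ ⊛-cong ≐-refl Q⊛W ⟩
    s² ⊛ 𝟙         ≈⟨ ⊛-identityʳ s² ⟩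
    s²             ∎
    where open ≐-Reasoning

≈-refl : ∀ {x} → x ≈ x
≈-refl n = refl

≈-sym : ∀ {x y} → x ≈ y → y ≈ x
≈-sym x≈y n = sym (x≈y n)

≈-trans : ∀ {x y z} → x ≈ y → y ≈ z → x ≈ z
≈-trans x≈y y≈z n = trans (x≈y n) (y≈z n)

coef-at : ∀ x {n k} → top x ℤ.- n ≡ + k → coef x n ≡ c x k
coef-at x {n} eq with top x ℤ.- n | eq
... | + _ | refl = refl

coef-above : ∀ x {n} → top x ℤ.< n → coef x n ≡ 0ℚ
coef-above x {n} top<n with top x ℤ.- n | ℤP.+-monoˡ-< (ℤ.- n) top<n
... | -[1+ _ ] | _     = refl
... | + k      | k<n-n = contradiction (subst (+ k ℤ.<_) (ℤP.+-inverseʳ n) k<n-n) λ { (ℤ.+<+ ()) }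

i-[i-j]≡j : ∀ i j → i ℤ.- (i ℤ.- j) ≡ j
i-[i-j]≡j = ℤ-Solver.solve-∀

coef-top : ∀ x k → coef x (top x ℤ.- + k) ≡ c x k
coef-top x k = coef-at x (i-[i-j]≡j (top x) (+ k))

minus≡-[1+]⇒< : ∀ {i j m} → i ℤ.- j ≡ -[1+ m ] → i ℤ.< j
minus≡-[1+]⇒< {i} {j} {m} eq = subst₂ ℤ._<_ (trans (cong (ℤ._+ j) (sym eq)) (cancel i j)) (ℤP.+-identityˡ j)
  (ℤP.+-monoˡ-< j ℤ.-<+)
  where
  cancel : ∀ i j → (i ℤ.- j) ℤ.+ j ≡ i
  cancel = ℤ-Solver.solve-∀

≈-by-coefficients : ∀ x y → top x ≡ top y → (∀ k → c x k ≡ c y k) → x ≈ y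
≈-by-coefficients x y top≡ c≗ n with top y ℤ.- n in eq
... | + k      = trans (coef-at x (trans (cong (ℤ._- n) top≡) eq)) (c≗ k)
... | -[1+ m ] = coef-above x (subst (ℤ._< n) (sym top≡) (minus≡-[1+]⇒< eq))

coef-⊕ : ∀ x y n → coef (x ⊕ y) n ≡ coef x n + coef y n
coef-⊕ x y n with (top x ℤ.⊔ top y) ℤ.- n in eq
... | + k      = cong₂ _+_ (cong (coef x) T-k≡n) (cong (coef y) T-k≡n)
  where
  T-k≡n : (top x ℤ.⊔ top y) ℤ.- + k ≡ n
  T-k≡n = trans (cong (λ i → (top x ℤ.⊔ top y) ℤ.- i) (sym eq)) (i-[i-j]≡j (top x ℤ.⊔ top y) n)
... | -[1+ m ] = sym (cong₂ _+_ (coef-above x (ℤP.≤-<-trans (ℤP.i≤i⊔j (top x) (top y)) T<n))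
                                 (coef-above y (ℤP.≤-<-trans (ℤP.i≤j⊔i (top x) (top y)) T<n)))
  where
  T<n = minus≡-[1+]⇒< eq

coef-· : ∀ q x n → coef (q · x) n ≡ q * coef x n
coef-· q x n with top x ℤ.- n
... | + k      = refl
... | -[1+ m ] = sym (ℚP.*-zeroʳ q)

record Padded (x′ x : Laurent) : Set where
  field
    top-suc : top x′ ≡ top x ℤ.+ + 1
    head≡0  : c x′ 0 ≡ 0ℚ
    tail≡   : ∀ k → c x′ (suc k) ≡ c x k
open Padded

padded-top-minus : ∀ {x′ x} → Padded x′ x → ∀ n → top x′ ℤ.- n ≡ (top x ℤ.- n) ℤ.+ + 1
padded-top-minus {x′} {x} pad n = trans (cong (ℤ._- n) (pad .top-suc)) (reorder (top x) n)
  where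
  reorder : ∀ i j → (i ℤ.+ + 1) ℤ.- j ≡ (i ℤ.- j) ℤ.+ + 1
  reorder = ℤ-Solver.solve-∀

padded-≈ : ∀ {x′ x} → Padded x′ x → x′ ≈ x
padded-≈ {x′} {x} pad n with top x ℤ.- n in eq | padded-top-minus pad n
... | + k          | shift = trans (coef-at x′ (trans shift (cong +_ (ℕP.+-comm k 1)))) (pad .tail≡ k)
... | -[1+ zero ]  | shift = trans (coef-at x′ shift) (pad .head≡0)
... | -[1+ suc m ] | shift = coef-above x′ (minus≡-[1+]⇒< shift)

⊗-paddedˡ : ∀ {x′ x} y → Padded x′ x → Padded (x′ ⊗ y) (x ⊗ y)
⊗-paddedˡ {x′} {x} y pad = record
  { top-suc = trans (cong (ℤ._+ top y) (pad .top-suc)) (reorder (top x) (top y))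
  ; head≡0  = trans (ℚP.+-identityˡ _) (trans (cong (_* c y 0) (pad .head≡0)) (ℚP.*-zeroˡ (c y 0)))
  ; tail≡   = tail
  }
  where
  open ≡-Reasoning
  reorder : ∀ i j → (i ℤ.+ + 1) ℤ.+ j ≡ (i ℤ.+ j) ℤ.+ + 1
  reorder = ℤ-Solver.solve-∀
  tail : ∀ k → c (x′ ⊗ y) (suc k) ≡ c (x ⊗ y) k
  tail k = begin
    sumTo (λ j → c x′ j * c y (suc k ∸ j)) (2 ℕ.+ k)
      ≡⟨ sumTo-suc _ (suc k) ⟩
    c x′ 0 * c y (suc k) + sumTo (λ j → c x′ (suc j) * c y (k ∸ j)) (suc k)
      ≡⟨ cong₂ _+_ (cong (_* c y (suc k)) (pad .head≡0)) (sumTo-cong (suc k) (λ {j} _ → cong (_* c y (k ∸ j)) (pad .tail≡ j))) ⟩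
    0ℚ * c y (suc k) + S
      ≡⟨ cong (_+ S) (ℚP.*-zeroˡ (c y (suc k))) ⟩
    0ℚ + S
      ≡⟨ ℚP.+-identityˡ S ⟩
    S
      ∎
    where
    S = sumTo (λ j → c x j * c y (k ∸ j)) (suc k)

⊗-paddedʳ : ∀ x {y′ y} → Padded y′ y → Padded (x ⊗ y′) (x ⊗ y)
⊗-paddedʳ x {y′} {y} pad = record
  { top-suc = trans (cong (λ i → top x ℤ.+ i) (pad .top-suc)) (sym (ℤP.+-assoc (top x) (top y) (+ 1)))
  ; head≡0  = trans (ℚP.+-identityˡ _) (trans (cong (c x 0 *_) (pad .head≡0)) (ℚP.*-zeroʳ (c x 0)))
  ; tail≡   = tail
  }
  where
  open ≡-Reasoning
  lower : ∀ {k j} → j ℕ.< suc k → c y′ (suc k ∸ j) ≡ c y (k ∸ j)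
  lower {k} {j} j<1+k = trans (cong (c y′) (ℕP.+-∸-assoc 1 (ℕP.m<1+n⇒m≤n j<1+k))) (pad .tail≡ (k ∸ j))
  tail : ∀ k → c (x ⊗ y′) (suc k) ≡ c (x ⊗ y) k
  tail k = begin
    sumTo (λ j → c x j * c y′ (suc k ∸ j)) (suc k) + c x (suc k) * c y′ (k ∸ k)
      ≡⟨ cong₂ _+_ (sumTo-cong (suc k) λ {j} j<1+k → cong (c x j *_) (lower j<1+k))
                   (cong (λ i → c x (suc k) * c y′ i) (ℕP.n∸n≡0 k)) ⟩
    S + c x (suc k) * c y′ 0
      ≡⟨ cong (λ r → S + c x (suc k) * r) (pad .head≡0) ⟩
    S + c x (suc k) * 0ℚ
      ≡⟨ cong (λ r → S + r) (ℚP.*-zeroʳ (c x (suc k))) ⟩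
    S + 0ℚ
      ≡⟨ ℚP.+-identityʳ S ⟩
    S
      ∎
    where
    S = sumTo (λ j → c x j * c y (k ∸ j)) (suc k)

deriv-padded : ∀ {x′ x} → Padded x′ x → Padded (deriv x′) (deriv x)
deriv-padded {x′} {x} pad = record
  { top-suc = trans (cong (ℤ._- + 1) (pad .top-suc)) (reorder (top x) (+ 1))
  ; head≡0  = trans (cong (ℤ→ℚ (top x′ ℤ.- + 0) *_) (pad .head≡0)) (ℚP.*-zeroʳ (ℤ→ℚ (top x′ ℤ.- + 0)))
  ; tail≡   = λ k → cong₂ _*_ (cong ℤ→ℚ (trans (cong (ℤ._- + suc k) (pad .top-suc)) (cancel (top x) (+ k))))
                               (pad .tail≡ k)
  }
  where
  reorder : ∀ i j → (i ℤ.+ + 1) ℤ.- j ≡ (i ℤ.- j) ℤ.+ + 1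
  reorder = ℤ-Solver.solve-∀
  cancel : ∀ i j → (i ℤ.+ + 1) ℤ.- (+ 1 ℤ.+ j) ≡ i ℤ.- j
  cancel = ℤ-Solver.solve-∀

-- Solutions of degree at least one

LaurentRiccati : (u₁ u₂ u₃ v₁ v₂ : ℚ) → Laurent → Set
LaurentRiccati u₁ u₂ u₃ v₁ v₂ x =
  (v₁ · (tL ⊗ tL) ⊕ const v₂) ⊗ deriv x ≈ const u₁ ⊕ u₂ · (tL ⊗ x) ⊕ u₃ · (x ⊗ x)

coef-riccati-rhs : ∀ u₁ u₂ u₃ x n → coef (const u₁ ⊕ u₂ · (tL ⊗ x) ⊕ u₃ · (x ⊗ x)) n
  ≡ coef (const u₁) n + u₂ * coef (tL ⊗ x) n + u₃ * coef (x ⊗ x) n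
coef-riccati-rhs u₁ u₂ u₃ x n = begin
  coef (const u₁ ⊕ u₂ · (tL ⊗ x) ⊕ u₃ · (x ⊗ x)) n
    ≡⟨ coef-⊕ (const u₁ ⊕ u₂ · (tL ⊗ x)) (u₃ · (x ⊗ x)) n ⟩
  coef (const u₁ ⊕ u₂ · (tL ⊗ x)) n + coef (u₃ · (x ⊗ x)) n
    ≡⟨ cong₂ _+_ (coef-⊕ (const u₁) (u₂ · (tL ⊗ x)) n) (coef-· u₃ (x ⊗ x) n) ⟩
  coef (const u₁) n + coef (u₂ · (tL ⊗ x)) n + u₃ * coef (x ⊗ x) n
    ≡⟨ cong (λ r → coef (const u₁) n + r + u₃ * coef (x ⊗ x) n) (coef-· u₂ (tL ⊗ x) n) ⟩
  coef (const u₁) n + u₂ * coef (tL ⊗ x) n + u₃ * coef (x ⊗ x) n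
    ∎
  where open ≡-Reasoning

module _ {u₁ u₂ u₃ v₁ v₂ : ℚ} where

  riccati-unpad : ∀ {x′ x} → Padded x′ x →
    LaurentRiccati u₁ u₂ u₃ v₁ v₂ x′ → LaurentRiccati u₁ u₂ u₃ v₁ v₂ x
  riccati-unpad {x′} {x} pad riccati n = begin
    coef (A ⊗ deriv x) n
      ≡⟨ padded-≈ (⊗-paddedʳ A (deriv-padded pad)) n ⟨
    coef (A ⊗ deriv x′) n
      ≡⟨ riccati n ⟩
    coef (const u₁ ⊕ u₂ · (tL ⊗ x′) ⊕ u₃ · (x′ ⊗ x′)) n
      ≡⟨ coef-riccati-rhs u₁ u₂ u₃ x′ n ⟩
    coef (const u₁) n + u₂ * coef (tL ⊗ x′) n + u₃ * coef (x′ ⊗ x′) n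
      ≡⟨ cong₂ (λ a b → coef (const u₁) n + u₂ * a + u₃ * b) (padded-≈ (⊗-paddedʳ tL pad) n)
           (trans (padded-≈ (⊗-paddedˡ x′ pad) n) (padded-≈ (⊗-paddedʳ x pad) n)) ⟩
    coef (const u₁) n + u₂ * coef (tL ⊗ x) n + u₃ * coef (x ⊗ x) n
      ≡⟨ coef-riccati-rhs u₁ u₂ u₃ x n ⟨
    coef (const u₁ ⊕ u₂ · (tL ⊗ x) ⊕ u₃ · (x ⊗ x)) n
      ∎
    where
    open ≡-Reasoning
    A = v₁ · (tL ⊗ tL) ⊕ const v₂

  riccati-leading-coefficient : ∀ M f → u₃ ≢ 0ℚ →
    LaurentRiccati u₁ u₂ u₃ v₁ v₂ (mkL (+ (2 ℕ.+ M)) f) → f 0 ≡ 0ℚ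
  riccati-leading-coefficient M f u₃≢0 riccati = p*p≡0⇒p≡0 (f 0) (p≢0∧p*q≡0⇒q≡0 u₃≢0 (begin
    u₃ * (f 0 * f 0)
      ≡⟨ simplify u₂ u₃ (f 0) ⟨
    0ℚ + u₂ * 0ℚ + u₃ * (0ℚ + f 0 * f 0)
      ≡⟨ cong₂ (λ a b → a + u₂ * b + u₃ * (0ℚ + f 0 * f 0))
           (coef-above (const u₁) {n} (ℤ.+<+ (s≤s z≤n))) (coef-above (tL ⊗ x) {n} (ℤ.+<+ 3+M<N+N)) ⟨
    coef (const u₁) n + u₂ * coef (tL ⊗ x) n + u₃ * (0ℚ + f 0 * f 0)
      ≡⟨ cong (λ r → coef (const u₁) n + u₂ * coef (tL ⊗ x) n + u₃ * r) (coef-at (x ⊗ x) {n} (ℤP.+-inverseʳ n)) ⟨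
    coef (const u₁) n + u₂ * coef (tL ⊗ x) n + u₃ * coef (x ⊗ x) n
      ≡⟨ coef-riccati-rhs u₁ u₂ u₃ x n ⟨
    coef (const u₁ ⊕ u₂ · (tL ⊗ x) ⊕ u₃ · (x ⊗ x)) n
      ≡⟨ riccati n ⟨
    coef (A ⊗ deriv x) n
      ≡⟨ coef-above (A ⊗ deriv x) (ℤ.+<+ 3+M<N+N) ⟩
    0ℚ
      ∎))
    where
    open ≡-Reasoning
    A = v₁ · (tL ⊗ tL) ⊕ const v₂
    N = 2 ℕ.+ M
    x = mkL (+ N) f
    n = + (N ℕ.+ N)
    3+M<N+N : 3 ℕ.+ M ℕ.< N ℕ.+ N
    3+M<N+N = s≤s (s≤s (ℕP.m≤n+m N M))
    simplify : ∀ u₂ u₃ a → 0ℚ + u₂ * 0ℚ + u₃ * (0ℚ + a * a) ≡ u₃ * (a * a)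
    simplify = solve-∀ ℚ-ring

  riccati-degree-one : ∀ M f → u₃ ≢ 0ℚ → LaurentRiccati u₁ u₂ u₃ v₁ v₂ (mkL (+ suc M) f) →
    Σ PowerSeries λ p → mkL (+ 1) p ≈ mkL (+ suc M) f × LaurentRiccati u₁ u₂ u₃ v₁ v₂ (mkL (+ 1) p)
  riccati-degree-one zero    f u₃≢0 riccati = f , ≈-refl {mkL (+ 1) f} , riccati
  riccati-degree-one (suc M) f u₃≢0 riccati =
    let p , p≈x′ , riccati′ = riccati-degree-one M (f ∘ suc) u₃≢0 (riccati-unpad pad riccati)
    in  p , ≈-trans {mkL (+ 1) p} {x′} {x} p≈x′ (≈-sym {x} {x′} (padded-≈ pad)) , riccati′
    where
    x  = mkL (+ (2 ℕ.+ M)) f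
    x′ = mkL (+ suc M) (f ∘ suc)
    pad : Padded x x′
    pad = record
      { top-suc = cong +_ (ℕP.+-comm 1 (suc M))
      ; head≡0  = riccati-leading-coefficient M f u₃≢0 riccati
      ; tail≡   = λ _ → refl
      }

  riccati-normal-form : u₃ ≢ 0ℚ → ∀ x → LaurentRiccati u₁ u₂ u₃ v₁ v₂ x → DegGe1 x →
    Σ PowerSeries λ p → mkL (+ 1) p ≈ x × LaurentRiccati u₁ u₂ u₃ v₁ v₂ (mkL (+ 1) p) × p 0 ≢ 0ℚ
  riccati-normal-form u₃≢0 (mkL (+ zero)  f) _ (_ , 0≢0) = contradiction refl 0≢0
  riccati-normal-form u₃≢0 (mkL -[1+ m ]  f) _ (_ , 0≢0) = contradiction refl 0≢0
  riccati-normal-form u₃≢0 (mkL (+ suc M) f) riccati (n , xₙ≢0) =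
    let p , p≈x , riccati₁ = riccati-degree-one M f u₃≢0 riccati
    in  p , p≈x , riccati₁ , degree-one-leading p (n , λ pₙ≡0 → xₙ≢0 (trans (sym (p≈x (+ suc n))) pₙ≡0))
    where
    degree-one-leading : ∀ p → DegGe1 (mkL (+ 1) p) → p 0 ≢ 0ℚ
    degree-one-leading p (zero  , p₀≢0) = p₀≢0
    degree-one-leading p (suc n , 0≢0)  = contradiction refl 0≢0

c-tL : ∀ k → c tL k ≡ 𝟙 k
c-tL zero    = refl
c-tL (suc k) = refl

coef-const : ∀ q k → coef (const q) (+ 2 ℤ.- + k) ≡ q * s² k
coef-const q 0 = sym (ℚP.*-zeroʳ q)
coef-const q 1 = sym (ℚP.*-zeroʳ q)
coef-const q 2 = sym (ℚP.*-identityʳ q)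
coef-const q (suc (suc (suc k))) = sym (ℚP.*-zeroʳ q)

c-⊗ : ∀ x y k → c (x ⊗ y) k ≡ (c x ⊛ c y) k
c-⊗ x y k = sym (⊛-at (c x) (c y) k)

c-tL⊗ : ∀ y k → c (tL ⊗ y) k ≡ c y k
c-tL⊗ y k = trans (c-⊗ tL y k) (trans (⊛-cong (pointwise c-tL) ≐-refl .at k) (⊛-identityˡ (c y) .at k))

c-quadratic : ∀ v w k → c (v · (tL ⊗ tL) ⊕ const w) k ≡ (ι v ⊞ ι w ⊛ s²) k
c-quadratic v w k = begin
  coef (v · (tL ⊗ tL)) (+ 2 ℤ.- + k) + coef (const w) (+ 2 ℤ.- + k)
    ≡⟨ cong₂ _+_ (coef-top (v · (tL ⊗ tL)) k) (coef-const w k) ⟩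
  v * c (tL ⊗ tL) k + w * s² k
    ≡⟨ cong (λ r → v * r + w * s² k) (trans (c-tL⊗ tL k) (c-tL k)) ⟩
  v * 𝟙 k + w * s² k
    ≡⟨ cong₂ _+_ (scale-𝟙 k) (sym (ι-⊛-at w s² k)) ⟩
  ι v k + (ι w ⊛ s²) k
    ≡⟨ ⊞-at (ι v) (ι w ⊛ s²) k ⟨
  (ι v ⊞ ι w ⊛ s²) k
    ∎
  where
  open ≡-Reasoning
  scale-𝟙 : ∀ k → v * 𝟙 k ≡ ι v k
  scale-𝟙 zero    = ℚP.*-identityʳ v
  scale-𝟙 (suc k) = ℚP.*-zeroʳ v

c-deriv : ∀ p k → c (deriv (mkL (+ 1) p)) k ≡ (p ⊞ ⊟ θ p) k
c-deriv p k = begin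
  ℤ→ℚ (+ 1 ℤ.- + k) * p k   ≡⟨ cong (_* p k) (ℤ→ℚ-1-n k) ⟩
  (1ℚ - ℕ→ℚ k) * p k        ≡⟨ distribute (ℕ→ℚ k) (p k) ⟩
  p k + - (ℕ→ℚ k * p k)     ≡⟨ cong (λ r → p k + - r) (θ-at p k) ⟨
  p k + - θ p k             ≡⟨ cong (λ r → p k + r) (⊟-at (θ p) k) ⟨
  p k + (⊟ θ p) k           ≡⟨ ⊞-at p (⊟ θ p) k ⟨
  (p ⊞ ⊟ θ p) k             ∎
  where
  open ≡-Reasoning
  distribute : ∀ n a → (1ℚ - n) * a ≡ a + - (n * a)
  distribute = solve-∀ ℚ-ring

riccati-power-series : ∀ {u₁ u₂ u₃ v₁ v₂ p} →
  LaurentRiccati u₁ u₂ u₃ v₁ v₂ (mkL (+ 1) p) → Riccati v₁ v₂ u₁ u₂ u₃ p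
riccati-power-series {u₁} {u₂} {u₃} {v₁} {v₂} {p} riccati = pointwise λ k → begin
  ((ι v₁ ⊞ ι v₂ ⊛ s²) ⊛ (p ⊞ ⊟ θ p)) k
    ≡⟨ ⊛-cong (pointwise (c-quadratic v₁ v₂)) (pointwise (c-deriv p)) .at k ⟨
  (c A ⊛ c (deriv x)) k
    ≡⟨ trans (coef-top (A ⊗ deriv x) k) (c-⊗ A (deriv x) k) ⟨
  coef (A ⊗ deriv x) (+ 2 ℤ.- + k)
    ≡⟨ riccati (+ 2 ℤ.- + k) ⟩
  coef (const u₁ ⊕ u₂ · (tL ⊗ x) ⊕ u₃ · (x ⊗ x)) (+ 2 ℤ.- + k)
    ≡⟨ coef-riccati-rhs u₁ u₂ u₃ x (+ 2 ℤ.- + k) ⟩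
  coef (const u₁) (+ 2 ℤ.- + k) + u₂ * coef (tL ⊗ x) (+ 2 ℤ.- + k) + u₃ * coef (x ⊗ x) (+ 2 ℤ.- + k)
    ≡⟨ cong₂ _+_ (cong₂ _+_ (coef-const u₁ k) (cong (u₂ *_) (trans (coef-top (tL ⊗ x) k) (c-tL⊗ x k))))
                 (cong (u₃ *_) (trans (coef-top (x ⊗ x) k) (c-⊗ x x k))) ⟩
  u₁ * s² k + u₂ * p k + u₃ * (p ⊛ p) k
    ≡⟨ cong₂ _+_ (cong₂ _+_ (ι-⊛-at u₁ s² k) (ι-⊛-at u₂ p k)) (ι-⊛-at u₃ (p ⊛ p) k) ⟨
  (ι u₁ ⊛ s²) k + (ι u₂ ⊛ p) k + (ι u₃ ⊛ (p ⊛ p)) k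
    ≡⟨ trans (⊞-at _ _ k) (cong (_+ (ι u₃ ⊛ (p ⊛ p)) k) (⊞-at (ι u₁ ⊛ s²) (ι u₂ ⊛ p) k)) ⟨
  (ι u₁ ⊛ s² ⊞ ι u₂ ⊛ p ⊞ ι u₃ ⊛ (p ⊛ p)) k
    ∎
  where
  open ≡-Reasoning
  x = mkL (+ 1) p
  A = v₁ · (tL ⊗ tL) ⊕ const v₂

-- The continued fraction

c-affine : ∀ β α P k → c (β · mkL (+ 1) P ⊖ α · tL) k ≡ (ι β ⊛ P ⊞ ι (- α)) k
c-affine β α P k = begin
  coef (β · mkL (+ 1) P) (+ 1 ℤ.- + k) + coef ((- 1ℚ) · (α · tL)) (+ 1 ℤ.- + k)
    ≡⟨ cong₂ _+_ (coef-top (β · mkL (+ 1) P) k) (coef-top ((- 1ℚ) · (α · tL)) k) ⟩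
  β * P k + (- 1ℚ) * (α * c tL k)
    ≡⟨ cong₂ _+_ (ι-⊛-at β P k) (sym (constant-term k)) ⟨
  (ι β ⊛ P) k + ι (- α) k
    ≡⟨ ⊞-at (ι β ⊛ P) (ι (- α)) k ⟨
  (ι β ⊛ P ⊞ ι (- α)) k
    ∎
  where
  open ≡-Reasoning
  constant-term : ∀ k → (- 1ℚ) * (α * c tL k) ≡ ι (- α) k
  constant-term zero    = negate α
    where
    negate : ∀ a → (- 1ℚ) * (a * 1ℚ) ≡ - a
    negate = solve-∀ ℚ-ring
  constant-term (suc k) = vanish α
    where
    vanish : ∀ a → (- 1ℚ) * (a * 0ℚ) ≡ 0ℚ
    vanish = solve-∀ ℚ-ring

s²≈1 : mkL (+ 2) s² ≈ const 1ℚ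
s²≈1 (+ 0)                   = refl
s²≈1 (+ 1)                   = refl
s²≈1 (+ 2)                   = refl
s²≈1 (+ suc (suc (suc n)))   = refl
s²≈1 -[1+ n ]                = refl

expansion-step : ∀ {β α P Q} → let Y = ι β ⊛ P ⊞ ι (- α) ; y = β · mkL (+ 1) P ⊖ α · tL in
  Y 0 ≡ 0ℚ → Y 1 ≡ 0ℚ → Y 2 ≢ 0ℚ → Q ⊛ Y ≐ s² →
  NonZeroL y × DegNeg y × (mkL (+ 1) Q ⊗ y ≈ const 1ℚ)
expansion-step {β} {α} {P} {Q} Y₀≡0 Y₁≡0 Y₂≢0 Q⊛Y≐s² = nonzero , negative-degree , inverse
  where
  y = β · mkL (+ 1) P ⊖ α · tL
  nonzero : NonZeroL y
  nonzero = -[1+ 0 ] , λ y₂≡0 → Y₂≢0 (trans (sym (c-affine β α P 2)) y₂≡0)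
  negative-degree : DegNeg y
  negative-degree zero          = trans (c-affine β α P 1) Y₁≡0
  negative-degree (suc zero)    = trans (c-affine β α P 0) Y₀≡0
  negative-degree (suc (suc n)) = refl
  inverse : mkL (+ 1) Q ⊗ y ≈ const 1ℚ
  inverse = ≈-trans {mkL (+ 1) Q ⊗ y} {mkL (+ 2) s²} {const 1ℚ}
    (≈-by-coefficients (mkL (+ 1) Q ⊗ y) (mkL (+ 2) s²) refl λ k →
      trans (c-⊗ (mkL (+ 1) Q) y k) (trans (⊛-cong ≐-refl (pointwise (c-affine β α P)) .at k) (Q⊛Y≐s² .at k)))
    s²≈1

module Expansion (u₁ u₂ u₃ v₁ v₂ : ℚ)
  (iv₁≢u₂ : ∀ (i : ℕ) → ¬ (ℕ→ℚ (suc i) * v₁ ≡ u₂))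
  (β≢0 : ∀ (i : ℕ) → ¬ ((ℕ→ℚ (suc i) * ℕ→ℚ (suc i) * v₁ - ℕ→ℚ (suc i) * u₂) * v₂ ≡ u₁ * u₃)) where

  α β : ℕ → ℚ
  α = alphaCF u₂ v₁
  β = betaSeq u₁ u₂ u₃ v₁ v₂

  U₁ U₂ : ℕ → ℚ
  U₁ zero    = u₁
  U₁ (suc _) = - 1ℚ
  -- equal to u₂ − 2i·v₁, written so that v₁ = α i + U₂ i is a ring identity
  U₂ i = v₁ - α i

  α-suc : ∀ i → α (suc i) ≡ (1ℚ + 1ℚ + ℕ→ℚ (suc (2 ℕ.* i))) * v₁ - u₂
  α-suc i = cong (λ n → n * v₁ - u₂) (trans (cong ℕ→ℚ (odd-suc i)) (ℕ→ℚ-+ 2 (suc (2 ℕ.* i))))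
    where
    odd-suc : ∀ i → suc (2 ℕ.* suc i) ≡ 2 ℕ.+ suc (2 ℕ.* i)
    odd-suc = ℕ-Solver.solve-∀

  v₁≡α+U₂ : ∀ i → v₁ ≡ α i + U₂ i
  v₁≡α+U₂ i = split v₁ (α i)
    where
    split : ∀ v a → v ≡ a + (v - a)
    split = solve-∀ ℚ-ring

  B≢0 : ∀ i → U₂ i + α i + α i ≢ 0ℚ
  B≢0 i B≡0 = iv₁≢u₂ (suc (2 ℕ.* i)) (ℚ-group.x∙y⁻¹≈ε⇒x≈y _ _ (begin
    ℕ→ℚ (2 ℕ.+ 2 ℕ.* i) * v₁ - u₂             ≡⟨ cong (λ n → n * v₁ - u₂) (ℕ→ℚ-suc (suc (2 ℕ.* i))) ⟩
    (1ℚ + ℕ→ℚ (suc (2 ℕ.* i))) * v₁ - u₂       ≡⟨ rearrange v₁ (ℕ→ℚ (suc (2 ℕ.* i))) u₂ ⟩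
    U₂ i + α i + α i                           ≡⟨ B≡0 ⟩
    0ℚ                                         ∎))
    where
    open ≡-Reasoning
    rearrange : ∀ v n u → (1ℚ + n) * v - u ≡ (v - (n * v - u)) + (n * v - u) + (n * v - u)
    rearrange = solve-∀ ℚ-ring

  U₂-suc : ∀ i → - (U₂ i + α i + α i) ≡ U₂ (suc i)
  U₂-suc i = trans (rearrange v₁ (ℕ→ℚ (suc (2 ℕ.* i))) u₂) (cong (λ a → v₁ - a) (sym (α-suc i)))
    where
    rearrange : ∀ v n u → - ((v - (n * v - u)) + (n * v - u) + (n * v - u)) ≡ v - ((1ℚ + 1ℚ + n) * v - u)
    rearrange = solve-∀ ℚ-ring

  β-suc : ∀ i → - (U₁ i * β i - α i * v₂) ≡ β (suc i)
  β-suc zero    = rearrange u₁ u₂ u₃ v₁ v₂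
    where
    rearrange : ∀ u₁ u₂ u₃ v₁ v₂ →
      - (u₁ * u₃ - (1ℚ * v₁ - u₂) * v₂) ≡ (1ℚ * 1ℚ * v₁ - 1ℚ * u₂) * v₂ - u₁ * u₃
    rearrange = solve-∀ ℚ-ring
  β-suc (suc j) = begin
    - (- 1ℚ * β (suc j) - (ℕ→ℚ (suc (2 ℕ.* suc j)) * v₁ - u₂) * v₂)
      ≡⟨ cong (λ a → - (- 1ℚ * β (suc j) - (a * v₁ - u₂) * v₂)) odd ⟩
    - (- 1ℚ * ((n * n * v₁ - n * u₂) * v₂ - u₁ * u₃) - ((1ℚ + (n + n)) * v₁ - u₂) * v₂)
      ≡⟨ rearrange n u₁ u₂ u₃ v₁ v₂ ⟩
    ((1ℚ + n) * (1ℚ + n) * v₁ - (1ℚ + n) * u₂) * v₂ - u₁ * u₃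
      ≡⟨ cong (λ m → (m * m * v₁ - m * u₂) * v₂ - u₁ * u₃) (ℕ→ℚ-suc (suc j)) ⟨
    β (2 ℕ.+ j)
      ∎
    where
    open ≡-Reasoning
    n = ℕ→ℚ (suc j)
    odd : ℕ→ℚ (suc (2 ℕ.* suc j)) ≡ 1ℚ + (n + n)
    odd = trans (cong ℕ→ℚ (double (suc j)))
            (trans (ℕ→ℚ-suc (suc j ℕ.+ suc j)) (cong (λ m → 1ℚ + m) (ℕ→ℚ-+ (suc j) (suc j))))
      where
      double : ∀ m → suc (2 ℕ.* m) ≡ suc (m ℕ.+ m)
      double = ℕ-Solver.solve-∀
    rearrange : ∀ n u₁ u₂ u₃ v₁ v₂ →
      - (- 1ℚ * ((n * n * v₁ - n * u₂) * v₂ - u₁ * u₃) - ((1ℚ + (n + n)) * v₁ - u₂) * v₂)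
      ≡ ((1ℚ + n) * (1ℚ + n) * v₁ - (1ℚ + n) * u₂) * v₂ - u₁ * u₃
    rearrange = solve-∀ ℚ-ring

  K≢0 : ∀ i → U₁ i * β i - α i * v₂ ≢ 0ℚ
  K≢0 i K≡0 = β≢0 i (ℚ-group.x∙y⁻¹≈ε⇒x≈y _ _ (begin
    β (suc i)                          ≡⟨ β-suc i ⟨
    - (U₁ i * β i - α i * v₂)          ≡⟨ cong -_ K≡0 ⟩
    - 0ℚ                               ≡⟨⟩
    0ℚ                                 ∎))
    where open ≡-Reasoning

  record Stage (i : ℕ) : Set where
    field
      series    : PowerSeries
      riccati   : Riccati v₁ v₂ (U₁ i) (U₂ i) (β i) series
      series₀≢0 : series 0 ≢ 0ℚ
  open Stage

  module Step {i} (s : Stage i) =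
    RiccatiStep (s .riccati) (s .series₀≢0) (v₁≡α+U₂ i) (B≢0 i) (K≢0 i)

  next : ∀ {i} → Stage i → Stage (suc i)
  next {i} s = record
    { series    = Step.Q s
    ; riccati   = subst₂ (λ U₂′ U₃′ → Riccati v₁ v₂ (- 1ℚ) U₂′ U₃′ (Step.Q s))
                         (U₂-suc i) (β-suc i) (Step.Q-riccati s)
    ; series₀≢0 = Step.Q₀≢0 s
    }

  module _ (initial : Stage 0) where

    stage : ∀ i → Stage i
    stage zero    = initial
    stage (suc i) = next (stage i)

    xs : ℕ → Laurent
    xs i = mkL (+ 1) (stage i .series)

    has-expansion : HasCF (xs 0) β (aSeq u₂ v₁)
    has-expansion = xs , ≈-refl {xs 0} , λ i →
      expansion-step (Step.Y₀≡0 (stage i)) (Step.Y₁≡0 (stage i)) (Step.W₀≢0 (stage i)) (Step.Q⊛Y (stage i))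

proposition3 : (u₁ u₂ u₃ v₁ v₂ : ℚ) →
    ¬ (u₂ ≡ 0ℚ) → ¬ (u₃ ≡ 0ℚ) → ¬ (v₁ ≡ 0ℚ) →
    (∀ (i : ℕ) → ¬ (ℕ→ℚ (suc i) * v₁ ≡ u₂)) →
    (∀ (i : ℕ) → ¬ ((ℕ→ℚ (suc i) * ℕ→ℚ (suc i) * v₁ - ℕ→ℚ (suc i) * u₂) * v₂ ≡ u₁ * u₃)) →
    (x : Laurent) →
    ((v₁ · (tL ⊗ tL) ⊕ const v₂) ⊗ deriv x
       ≈ const u₁ ⊕ u₂ · (tL ⊗ x) ⊕ u₃ · (x ⊗ x)) →
    DegGe1 x →
    HasCF x (betaSeq u₁ u₂ u₃ v₁ v₂) (aSeq u₂ v₁)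
proposition3 u₁ u₂ u₃ v₁ v₂ _ u₃≢0 _ iv₁≢u₂ β≢0 x riccati deg≥1 =
  let p , p≈x , riccatiₚ , p₀≢0 = riccati-normal-form {u₁} {u₂} {u₃} {v₁} {v₂} u₃≢0 x riccati deg≥1
      xs , xs₀≈p , steps = Expansion.has-expansion u₁ u₂ u₃ v₁ v₂ iv₁≢u₂ β≢0 (record
        { series    = p
        ; riccati   = subst (λ U₂ → Riccati v₁ v₂ u₁ U₂ u₃ p) (u₂≡U₂₀ u₂ v₁) (riccati-power-series riccatiₚ)
        ; series₀≢0 = p₀≢0
        })
  in  xs , ≈-trans {xs 0} {mkL (+ 1) p} {x} xs₀≈p p≈x , steps
  where
  u₂≡U₂₀ : ∀ u v → u ≡ v - (1ℚ * v - u)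
  u₂≡U₂₀ = solve-∀ ℚ-ring
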